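{- Let $S=\{x_1,\ldots,x_n\}$ be a gcd-closed set of distinct positive integers, let $G_S(x_n)=\{y_{n,1},\ldots,y_{n,m}\}$ (with $m\ge1$) and $D_S(x_n)=\{x_{n_1},\ldots,x_{n_t}\}$. Then $$[y_{n,1},\ldots,y_{n,m}]=\frac{\prod_{i=1}^{m}y_{n,i}}{\prod_{k=1}^{t}x_{n_k}^{c_{n_kn}}},$$ and moreover $\sum_{k=1}^{t}c_{n_kn}=m-1$.
   Context: $[a_1,\ldots,a_m]$ denotes the lcm and $(a_1,\ldots,a_m)$ the gcd. $\mu$ is the Möbius function. $S$ is gcd-closed if $\gcd(x,y)\in S$ for all $x,y\in S$. For $x<y$ in $S$, $x$ is a greatest-type divisor of $y$ in $S$ if $x\mid y$ and $x\mid z\mid y$, $z\in S$ imply $z\in\{x,y\}$; $G_S(y)$ is the set of greatest-type divisors of $y$ in $S$. If $G_S(x_k)=\{y_{k,1},\ldots,y_{k,m}\}$, then $D_S(x_k)=\{\gcd(y_{k,i_1},\ldots,y_{k,i_r}): 2\le r\le m,\ 1\le i_1<\cdots<i_r\le m\}$. For $x_i,x_j\in S$, $c_{ij}=\sum\mu(d)$ over positive integers $d$ with $dx_i\mid x_j$ and $dx_i\nmid x_t$ for every $x_t\in S$ with $x_t<x_j$. -}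

module Defs where

open import Data.Nat using (ℕ; zero; suc; _+_; _*_; _∸_; _^_; _≤_; _<_; _≤?_; _<?_)
open import Data.Nat.Divisibility using (_∣_; _∣?_)
open import Data.Nat.DivMod using (_/_)
open import Data.Nat.GCD using (gcd)
open import Data.Nat.LCM using (lcm)
open import Data.Integer as ℤ using (ℤ; +_; -[1+_])
open import Data.List using (List; []; _∷_; foldr; length; map; sum; product)
open import Data.List.Membership.Propositional using (_∈_)
open import Data.List.Relation.Unary.All using (All; all?)
open import Data.List.Relation.Unary.Unique.Propositional using (Unique)
open import Data.Product using (Σ; _×_; ∃)
open import Data.Sum using (_⊎_)
open import Data.Bool using (Bool; true; false; if_then_else_; _∧_)
open import Relation.Nullary using (¬_; Dec; yes; no; contradiction)
open import Relation.Nullary.Decidable using (⌊_⌋; ¬?)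
open import Relation.Binary.PropositionalEquality using (_≡_)

-- Möbius function: μ(n) = (-1)^k if n is squarefree with k prime
-- factors, 0 if n is not squarefree; μ(1) = 1.  (μ 0 = 0 by convention,
-- never used.)  Computed by trial division with increasing candidate
-- p starting at 2: the first p dividing the current cofactor is prime;
-- if p² divides it, the value is 0, otherwise we remove p, flip the
-- sign and continue with p+1.  The fuel 2n is more than sufficient.

μ-go : ℕ → ℕ → ℕ → ℤ
μ-go zero    n p = + 1
μ-go (suc f) n p with n ≤? 1
... | yes _ = + 1
... | no  _ with p ∣? n
...   | no  _ = μ-go f n (suc p)
...   | yes _ with (p * p) ∣? n
...     | yes _ = + 0
...     | no  _ with p
...       | zero  = + 0
...       | suc q = ℤ.- μ-go f (n / suc q) (suc (suc q))

μ : ℕ → ℤ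
μ zero    = + 0
μ (suc n) = μ-go (2 * suc n) (suc n) 2

lcmList : List ℕ → ℕ
lcmList = foldr lcm 1

gcdList : List ℕ → ℕ
gcdList = foldr gcd 0

-- gcd-closed sets (finite sets of naturals given as duplicate-free lists)

GcdClosed : List ℕ → Set
GcdClosed S = ∀ x y → x ∈ S → y ∈ S → gcd x y ∈ S

IsGreatestTypeDivisor : List ℕ → ℕ → ℕ → Set
IsGreatestTypeDivisor S x y =
  x ∈ S × y ∈ S × x < y × x ∣ y ×
  (∀ z → z ∈ S → x ∣ z → z ∣ y → z ≡ x ⊎ z ≡ y)

-- membership in D_S(y), where G lists G_S(y):
-- d is the gcd of r ≥ 2 distinct elements of G_S(y)
InD : List ℕ → ℕ → Set
InD G d = Σ (List ℕ) λ T →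
  Unique T × All (_∈ G) T × 2 ≤ length T × gcdList T ≡ d

-- c_{ij} = Σ μ(d) over positive d with d·xi ∣ xj and d·xi ∤ xt for all
-- xt ∈ S with xt < xj.  (Such d satisfy d ≤ xj when xj > 0.)

c-cond : List ℕ → ℕ → ℕ → ℕ → Bool
c-cond S xi xj d =
  ⌊ (d * xi) ∣? xj ⌋ ∧
  ⌊ all? (λ xt → dec xt) S ⌋
  where
  dec : (xt : ℕ) → Dec (xt < xj → ¬ (d * xi ∣ xt))
  dec xt with xt <? xj
  ... | no ¬lt = yes (λ lt → contradiction lt ¬lt)
  ... | yes lt with (d * xi) ∣? xt
  ...   | yes dv = no (λ f → f lt dv)
  ...   | no ¬dv = yes (λ _ → ¬dv)

c-sum : List ℕ → ℕ → ℕ → ℕ → ℤ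
c-sum S xi xj zero    = + 0
c-sum S xi xj (suc d) =
  (if c-cond S xi xj (suc d) then μ (suc d) else + 0) ℤ.+ c-sum S xi xj d

c : List ℕ → ℕ → ℕ → ℤ
c S xi xj = c-sum S xi xj xj

pos neg : ℤ → ℕ
pos (+ n)    = n
pos -[1+ n ] = 0
neg (+ n)    = 0
neg -[1+ n ] = suc n

sumℤ : List ℤ → ℤ
sumℤ = foldr ℤ._+_ (+ 0)

module Submission where

-- For a divisor k·d of X, gcd-closedness makes "k·d ∤ x_t for all
-- x_t < X in S" equivalent to "k·d ∤ y for all y ∈ ys", so c(d,X) is a
-- sieve sum.  Inclusion–exclusion over the subsets J ⊆ ys and the Möbius
-- identity Σ_{k∣q} μ k = [q = 1] give  c(d,X) = Σ_J (−1)^|J| [gcd(X, gcd J) = d].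
-- For d ∈ D only the J with |J| ≥ 2 contribute, and every such J has
-- gcd J ∈ D; so c(d,X) = E(d) − O(d), the numbers of even/odd J, |J| ≥ 2,
-- with gcd J = d.  Summing over D yields Σ_{|J|≥2} (−1)^|J| = m − 1, and
-- multiplying d^E(d), d^O(d) over D reduces the first claim to
-- inclusion–exclusion for the lcm:  lcm Y · Π_{|J|≥2 even} gcd J = Π_{|J| odd} gcd J.

open import Defs
open import Data.Nat using (ℕ; _*_; _^_; _≤_; _<_; _∸_)
open import Data.Integer as ℤ using (ℤ; +_)
open import Data.List using (List; length; map)
open import Data.Nat.ListAction using (product)
open import Data.List.Membership.Propositional using (_∈_)
open import Data.List.Relation.Unary.All using (All)
open import Data.List.Relation.Unary.Unique.Propositional using (Unique)
open import Data.Product using (_×_)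
open import Function.Bundles using (_⇔_)
open import Relation.Binary.PropositionalEquality using (_≡_)

open import Algebra.Structures using (IsCommutativeMonoid)
open import Data.Bool using (Bool; true; false; if_then_else_; not; _∧_; T)
open import Data.Bool.ListAction using (all)
open import Data.Bool.Properties using (T-∧)
open import Data.Empty using (⊥-elim)
open import Data.Integer using (-[1+_])
import Data.Integer.Properties as ℤP
open import Data.Integer.Tactic.RingSolver renaming (solve-∀ to ℤ-solve-∀)
open import Data.List using ([]; _∷_; _++_; foldr; applyDownFrom)
open import Data.List.Properties using (map-++; map-∘; length-map)
open import Data.List.Membership.Propositional using (_∉_; find; lose)
open import Data.List.Relation.Unary.All using ([]; _∷_)
import Data.List.Relation.Unary.All as All
import Data.List.Relation.Unary.All.Properties as AllP
import Data.List.Relation.Unary.AllPairs as AllPairs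
open import Data.List.Relation.Unary.Any using (here; there; any?)
open import Data.Nat using (zero; suc; _+_; _≤?_; _≟_; z≤n; s≤s; NonZero; >-nonZero; n>1⇒nonTrivial)
open import Data.Nat.Properties
open import Data.Nat.Divisibility
open import Data.Nat.DivMod using (_/_; m/n≤m; m≥n⇒m/n>0; m*n/n≡m)
open import Data.Nat.GCD
  using (gcd; gcd[m,n]∣m; gcd[m,n]∣n; gcd-greatest; gcd-assoc; gcd-identityˡ; gcd-identityʳ; gcd-zeroʳ;
         gcd[m,n]≢0; c*gcd[m,n]≡gcd[cm,cn])
open import Data.Nat.LCM using (lcm; lcm-least; m∣lcm[m,n]; n∣lcm[m,n]; gcd*lcm)
open import Data.Nat.ListAction.Properties using (product≢0)
open import Data.Nat.Primality
open import Data.Nat.Tactic.RingSolver using (solve-∀)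
open import Data.Product using (Σ; _,_; proj₁; proj₂)
open import Data.Sum using (_⊎_; inj₁; inj₂)
open import Data.Unit using (tt)
open import Function.Bundles using (Equivalence)
open import Relation.Binary.PropositionalEquality
  using (_≢_; refl; sym; trans; cong; cong₂; subst; module ≡-Reasoning)
open import Relation.Nullary using (¬_; Dec; yes; no; contradiction; ¬?; _×-dec_)
open import Relation.Nullary.Decidable using (⌊_⌋; toWitness; fromWitness)

module BigOperator {C : Set} {_∙_ : C → C → C} {ε : C}
                   (isCM : IsCommutativeMonoid _≡_ _∙_ ε) where

  open IsCommutativeMonoid isCM using (assoc; comm; identityˡ)

  fold : {A : Set} → List A → (A → C) → C
  fold as f = foldr _∙_ ε (map f as)

  fold-++ : ∀ {A : Set} (as bs : List A) (f : A → C) → fold (as ++ bs) f ≡ fold as f ∙ fold bs f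
  fold-++ []       bs f = sym (identityˡ _)
  fold-++ (a ∷ as) bs f = trans (cong (f a ∙_) (fold-++ as bs f)) (sym (assoc (f a) _ _))

  fold-map : ∀ {A B : Set} (g : A → B) (as : List A) (f : B → C) →
             fold (map g as) f ≡ fold as (λ a → f (g a))
  fold-map g []       f = refl
  fold-map g (a ∷ as) f = cong (f (g a) ∙_) (fold-map g as f)

  fold-cong : ∀ {A : Set} {P : A → Set} {as : List A} {f g : A → C} →
              All P as → (∀ {a} → P a → f a ≡ g a) → fold as f ≡ fold as g
  fold-cong []        _  = refl
  fold-cong (pa ∷ ps) eq = cong₂ _∙_ (eq pa) (fold-cong ps eq)

  fold-ext : ∀ {A : Set} (as : List A) {f g : A → C} → (∀ a → f a ≡ g a) → fold as f ≡ fold as g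
  fold-ext []       eq = refl
  fold-ext (a ∷ as) eq = cong₂ _∙_ (eq a) (fold-ext as eq)

  fold-ε : ∀ {A : Set} (as : List A) → fold as (λ _ → ε) ≡ ε
  fold-ε []       = refl
  fold-ε (a ∷ as) = trans (identityˡ _) (fold-ε as)

  fold-∙ : ∀ {A : Set} (as : List A) (f g : A → C) →
           fold as (λ a → f a ∙ g a) ≡ fold as f ∙ fold as g
  fold-∙ []       f g = sym (identityˡ ε)
  fold-∙ (a ∷ as) f g = trans (cong ((f a ∙ g a) ∙_) (fold-∙ as f g)) (interchange (f a) (g a) _ _)
    where
    interchange : ∀ w x y z → (w ∙ x) ∙ (y ∙ z) ≡ (w ∙ y) ∙ (x ∙ z)
    interchange w x y z = begin
      (w ∙ x) ∙ (y ∙ z)  ≡⟨ assoc w x (y ∙ z) ⟩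
      w ∙ (x ∙ (y ∙ z))  ≡⟨ cong (w ∙_) (sym (assoc x y z)) ⟩
      w ∙ ((x ∙ y) ∙ z)  ≡⟨ cong (λ t → w ∙ (t ∙ z)) (comm x y) ⟩
      w ∙ ((y ∙ x) ∙ z)  ≡⟨ cong (w ∙_) (assoc y x z) ⟩
      w ∙ (y ∙ (x ∙ z))  ≡⟨ sym (assoc w y (x ∙ z)) ⟩
      (w ∙ y) ∙ (x ∙ z)  ∎
      where open ≡-Reasoning

  fold-swap : ∀ {A B : Set} (as : List A) (bs : List B) (f : A → B → C) →
              fold as (λ a → fold bs (f a)) ≡ fold bs (λ b → fold as (λ a → f a b))
  fold-swap []       bs f = sym (fold-ε bs)
  fold-swap (a ∷ as) bs f =
    trans (cong (fold bs (f a) ∙_) (fold-swap as bs f)) (sym (fold-∙ bs (f a) _))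

fold-hom : ∀ {A C D : Set} {_∙_ : C → C → C} {ε : C} {_∘_ : D → D → D} {ε′ : D}
           (h : C → D) → h ε ≡ ε′ → (∀ x y → h (x ∙ y) ≡ h x ∘ h y) →
           ∀ (as : List A) (f : A → C) →
           h (foldr _∙_ ε (map f as)) ≡ foldr _∘_ ε′ (map (λ a → h (f a)) as)
fold-hom h hε h∙ []       f = hε
fold-hom {_∘_ = _∘_} h hε h∙ (a ∷ as) f =
  trans (h∙ (f a) _) (cong (h (f a) ∘_) (fold-hom h hε h∙ as f))

module ∑ℤ = BigOperator ℤP.+-0-isCommutativeMonoid
module ∑  = BigOperator +-0-isCommutativeMonoid
module ∏  = BigOperator *-1-isCommutativeMonoid

∑ℤ-neg : ∀ {A : Set} (as : List A) (f : A → ℤ) → ∑ℤ.fold as (λ a → ℤ.- f a) ≡ ℤ.- ∑ℤ.fold as f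
∑ℤ-neg as f = sym (fold-hom ℤ.-_ refl ℤP.neg-distrib-+ as f)

∑ℤ-difference : ∀ {A : Set} (as : List A) (f g : A → ℕ) →
  ∑ℤ.fold as (λ a → + f a ℤ.- + g a) ≡ + ∑.fold as f ℤ.- + ∑.fold as g
∑ℤ-difference as f g = begin
  ∑ℤ.fold as (λ a → + f a ℤ.- + g a)                           ≡⟨ ∑ℤ.fold-∙ as (λ a → + f a) (λ a → ℤ.- + g a) ⟩
  ∑ℤ.fold as (λ a → + f a) ℤ.+ ∑ℤ.fold as (λ a → ℤ.- + g a)    ≡⟨ cong₂ ℤ._+_ (∑ℤ-pos f) (trans (∑ℤ-neg as (λ a → + g a)) (cong ℤ.-_ (∑ℤ-pos g))) ⟩
  + ∑.fold as f ℤ.- + ∑.fold as g                               ∎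
  where
  open ≡-Reasoning
  ∑ℤ-pos : ∀ h → ∑ℤ.fold as (λ a → + h a) ≡ + ∑.fold as h
  ∑ℤ-pos h = sym (fold-hom +_ refl ℤP.pos-+ as h)

∑-scale : ∀ {A : Set} (as : List A) c (f : A → ℕ) → ∑.fold as (λ a → c * f a) ≡ c * ∑.fold as f
∑-scale as c f = sym (fold-hom (c *_) (*-zeroʳ c) (*-distribˡ-+ c) as f)

power-∑ : ∀ {A : Set} x (as : List A) (f : A → ℕ) → x ^ ∑.fold as f ≡ ∏.fold as (λ a → x ^ f a)
power-∑ x as f = fold-hom (x ^_) refl (^-distribˡ-+-* x) as f

δ : ℕ → ℕ → ℕ
δ a b = if ⌊ a ≟ b ⌋ then 1 else 0

δ-refl : ∀ x → δ x x ≡ 1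
δ-refl x with x ≟ x
... | yes _   = refl
... | no  x≢x = contradiction refl x≢x

δ-≢ : ∀ {x d} → x ≢ d → δ x d ≡ 0
δ-≢ {x} {d} x≢d with x ≟ d
... | yes x≡d = contradiction x≡d x≢d
... | no  _   = refl

∑δ-∉ : ∀ {x} ds → x ∉ ds → ∑.fold ds (δ x) ≡ 0
∑δ-∉ []       _   = refl
∑δ-∉ (d ∷ ds) x∉ = cong₂ _+_ (δ-≢ (λ x≡d → x∉ (here x≡d))) (∑δ-∉ ds (λ x∈ → x∉ (there x∈)))

∑δ-∈ : ∀ {x} ds → Unique ds → x ∈ ds → ∑.fold ds (δ x) ≡ 1
∑δ-∈ {x} (d ∷ ds) (d≢ AllPairs.∷ _) (here refl) =
  cong₂ _+_ (δ-refl x) (∑δ-∉ ds (λ x∈ → All.lookup d≢ x∈ refl))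
∑δ-∈ (d ∷ ds) (d≢ AllPairs.∷ u) (there x∈) =
  cong₂ _+_ (δ-≢ (λ x≡d → All.lookup d≢ x∈ (sym x≡d))) (∑δ-∈ ds u x∈)

∏δ : ∀ x w ds → ∏.fold ds (λ d → d ^ (w * δ x d)) ≡ x ^ (w * ∑.fold ds (δ x))
∏δ x w ds = trans (∏.fold-ext ds only-x)
  (sym (fold-hom (λ n → x ^ (w * n)) (cong (x ^_) (*-zeroʳ w)) power-+ ds (δ x)))
  where
  only-x : ∀ d → d ^ (w * δ x d) ≡ x ^ (w * δ x d)
  only-x d with x ≟ d
  ... | yes refl = refl
  ... | no  _    = trans (cong (d ^_) (*-zeroʳ w)) (cong (x ^_) (sym (*-zeroʳ w)))
  power-+ : ∀ m n → x ^ (w * (m + n)) ≡ x ^ (w * m) * x ^ (w * n)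
  power-+ m n = trans (cong (x ^_) (*-distribˡ-+ w m n)) (^-distribˡ-+-* x (w * m) (w * n))

μ-go-finished : ∀ f n p → n ≤ 1 → μ-go f n p ≡ + 1
μ-go-finished zero    n p _   = refl
μ-go-finished (suc f) n p n≤1 with n ≤? 1
... | yes _   = refl
... | no  n≰1 = contradiction n≤1 n≰1

μ-go-skip : ∀ f n p → 1 < n → ¬ p ∣ n → μ-go (suc f) n p ≡ μ-go f n (suc p)
μ-go-skip f n p 1<n p∤n with n ≤? 1
... | yes n≤1 = contradiction n≤1 (<⇒≱ 1<n)
... | no  _ with p ∣? n
...   | yes p∣n = contradiction p∣n p∤n
...   | no  _   = refl

μ-go-square : ∀ f n p → 1 < n → p * p ∣ n → μ-go (suc f) n p ≡ + 0
μ-go-square f n p 1<n p²∣n with n ≤? 1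
... | yes n≤1 = contradiction n≤1 (<⇒≱ 1<n)
... | no  _ with p ∣? n
...   | no  p∤n = contradiction (m*n∣⇒m∣ p p p²∣n) p∤n
...   | yes _ with (p * p) ∣? n
...     | yes _    = refl
...     | no  p²∤n = contradiction p²∣n p²∤n

μ-go-divide : ∀ f n q → 1 < n → suc q ∣ n → ¬ suc q * suc q ∣ n →
              μ-go (suc f) n (suc q) ≡ ℤ.- μ-go f (n / suc q) (suc (suc q))
μ-go-divide f n q 1<n p∣n p²∤n with n ≤? 1
... | yes n≤1 = contradiction n≤1 (<⇒≱ 1<n)
... | no  _ with suc q ∣? n
...   | no  p∤n = contradiction p∣n p∤n
...   | yes _ with (suc q * suc q) ∣? n
...     | yes p²∣n = contradiction p²∣n p²∤n
...     | no  _    = refl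

-- A loop state (n , p) is valid when 1 ≤ n, 2 ≤ p and n has no
-- divisor in [2, p); then p ≤ n unless n = 1, so fuel f is sufficient
-- when n + 2 ≤ f + p.

rough-≤ : ∀ {p n} → 1 < n → p Rough n → p ≤ n
rough-≤ 1<n r = rough⇒≤ {{n>1⇒nonTrivial 1<n}} r

no-fuel : ∀ {n p} → p ≤ n → ¬ (n + 2 ≤ p)
no-fuel {n} p≤n h = <⇒≱ (m<m+n n {2} (s≤s z≤n)) (≤-trans h p≤n)

fuel-shift : ∀ {a f p} → a ≤ suc f + p → a ≤ f + suc p
fuel-shift {a} {f} {p} h = ≤-trans h (≤-reflexive (sym (+-suc f p)))

rough-divide : ∀ {n p} .{{_ : NonZero p}} → p Rough n → p ∣ n → ¬ p * p ∣ n →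
               suc p Rough (n / p)
rough-divide r p∣n p²∤n =
  ∤⇒rough-suc (λ p∣n/p → p²∤n (m∣n/o⇒m*o∣n p∣n p∣n/p)) (rough∧∣⇒rough r (m/n∣m p∣n))

μ-go-fuel : ∀ f f′ n p → 2 ≤ p → p Rough n → 1 ≤ n →
            n + 2 ≤ f + p → n + 2 ≤ f′ + p → μ-go f n p ≡ μ-go f′ n p
μ-go-fuel f f′ n (suc q) (s≤s 1≤q) r 1≤n h h′ with n ≤? 1
... | yes n≤1 = trans (μ-go-finished f n p n≤1) (sym (μ-go-finished f′ n p n≤1))
  where p = suc q
... | no  n≰1 = run f f′ h h′
  where
  p = suc q
  1<n : 1 < n
  1<n = ≰⇒> n≰1
  p≤n : p ≤ n
  p≤n = rough-≤ 1<n r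
  quotient-fuel : ∀ {g} → n + 2 ≤ suc g + p → n / p + 2 ≤ g + suc p
  quotient-fuel h = fuel-shift (≤-trans (+-monoˡ-≤ 2 (m/n≤m n p)) h)
  run : ∀ g g′ → n + 2 ≤ g + p → n + 2 ≤ g′ + p → μ-go g n p ≡ μ-go g′ n p
  run zero    _        h _  = ⊥-elim (no-fuel p≤n h)
  run (suc g) zero     _ h′ = ⊥-elim (no-fuel p≤n h′)
  run (suc g) (suc g′) h h′ with p ∣? n
  ... | no p∤n = trans (μ-go-skip g n p 1<n p∤n) (trans
        (μ-go-fuel g g′ n (suc p) (s≤s (m≤n⇒m≤1+n 1≤q)) (∤⇒rough-suc p∤n r) 1≤n
                   (fuel-shift h) (fuel-shift h′))
        (sym (μ-go-skip g′ n p 1<n p∤n)))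
  ... | yes p∣n with (p * p) ∣? n
  ...   | yes p²∣n = trans (μ-go-square g n p 1<n p²∣n) (sym (μ-go-square g′ n p 1<n p²∣n))
  ...   | no  p²∤n = trans (μ-go-divide g n q 1<n p∣n p²∤n) (trans
        (cong ℤ.-_ (μ-go-fuel g g′ (n / p) (suc p) (s≤s (m≤n⇒m≤1+n 1≤q))
                     (rough-divide r p∣n p²∤n) (m≥n⇒m/n>0 p≤n)
                     (quotient-fuel h) (quotient-fuel h′)))
        (sym (μ-go-divide g′ n q 1<n p∣n p²∤n)))

μ-go-skip-many : ∀ k f n q → 2 ≤ q → 1 < n → (q + k) Rough n →
                 μ-go (k + f) n q ≡ μ-go f n (q + k)
μ-go-skip-many zero    f n q _   _   _ = cong (μ-go f n) (sym (+-identityʳ q))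
μ-go-skip-many (suc k) f n q 2≤q 1<n r = begin
  μ-go (suc k + f) n q     ≡⟨ μ-go-skip (k + f) n q 1<n q∤n ⟩
  μ-go (k + f) n (suc q)   ≡⟨ μ-go-skip-many k f n (suc q) (m≤n⇒m≤1+n 2≤q) 1<n
                                (subst (_Rough n) (+-suc q k) r) ⟩
  μ-go f n (suc q + k)     ≡⟨ cong (μ-go f n) (sym (+-suc q k)) ⟩
  μ-go f n (q + suc k)     ∎
  where
  open ≡-Reasoning
  q∤n : ¬ q ∣ n
  q∤n q∣n = r (hasNonTrivialDivisor {{n>1⇒nonTrivial 2≤q}} (m<m+n q (s≤s z≤n)) q∣n)

μ-go-correct : ∀ f n p → 2 ≤ p → p Rough n → 1 ≤ n → n + 2 ≤ f + p → μ-go f n p ≡ μ n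
μ-go-correct f (suc zero)      p             _         _ _ _ = μ-go-finished f 1 p ≤-refl
μ-go-correct f (suc (suc _))  (suc zero)    (s≤s ()) _ _ _
μ-go-correct f N@(suc (suc _)) (suc (suc k)) 2≤p r 1≤n h = begin
  μ-go f N (2 + k)      ≡⟨ μ-go-fuel f F N (2 + k) 2≤p r 1≤n h F-enough ⟩
  μ-go F N (2 + k)      ≡⟨ sym (μ-go-skip-many k F N 2 ≤-refl 1<N r) ⟩
  μ-go (k + F) N 2      ≡⟨ cong (λ g → μ-go g N 2) k+F≡2N ⟩
  μ-go (2 * N) N 2      ∎
  where
  open ≡-Reasoning
  1<N : 1 < N
  1<N = s≤s (s≤s z≤n)
  k≤2N : k ≤ 2 * N
  k≤2N = ≤-trans (≤-trans (n≤1+n k) (n≤1+n (suc k)))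
                 (≤-trans (rough-≤ 1<N r) (m≤m+n N (N + 0)))
  F = 2 * N ∸ k
  k+F≡2N : k + F ≡ 2 * N
  k+F≡2N = m+[n∸m]≡n k≤2N
  F-enough : N + 2 ≤ F + (2 + k)
  F-enough = subst (N + 2 ≤_) (sym (trans (+-comm F (2 + k)) (cong (λ x → 2 + x) k+F≡2N)))
                   (≤-trans (≤-reflexive (+-comm N 2)) (+-monoʳ-≤ 2 (m≤m+n N (N + 0))))

μ-least-simple : ∀ q k → 2 ≤ q → q Rough (q * k) → 1 ≤ k → ¬ q ∣ k → μ (q * k) ≡ ℤ.- μ k
μ-least-simple (suc zero)     _        (s≤s ()) _ _ _
μ-least-simple (suc (suc q₀)) (suc k₀) 2≤q r 1≤k q∤k = begin
  μ (q * k)                         ≡⟨ sym (μ-go-correct (suc f) (q * k) q 2≤q r (s≤s z≤n) fuel) ⟩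
  μ-go (suc f) (q * k) q            ≡⟨ μ-go-divide f (q * k) (suc q₀) 1<qk (m∣m*n k) q²∤qk ⟩
  ℤ.- μ-go f (q * k / q) (suc q)    ≡⟨ cong (λ m → ℤ.- μ-go f m (suc q)) qk/q≡k ⟩
  ℤ.- μ-go f k (suc q)              ≡⟨ cong ℤ.-_ (μ-go-correct f k (suc q) (m≤n⇒m≤1+n 2≤q) r′ 1≤k fuel′) ⟩
  ℤ.- μ k                           ∎
  where
  open ≡-Reasoning
  q = suc (suc q₀)
  k = suc k₀
  f = q * k + 2
  1<qk : 1 < q * k
  1<qk = ≤-trans 2≤q (m≤m*n q k)
  q²∤qk : ¬ q * q ∣ q * k
  q²∤qk q²∣qk = q∤k (*-cancelˡ-∣ q q²∣qk)
  qk/q≡k : q * k / q ≡ k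
  qk/q≡k = trans (cong (_/ q) (*-comm q k)) (m*n/n≡m k q)
  r′ : suc q Rough k
  r′ = ∤⇒rough-suc q∤k (rough∧∣⇒rough r (n∣m*n q))
  fuel : q * k + 2 ≤ suc f + q
  fuel = ≤-trans (n≤1+n _) (m≤m+n (suc f) q)
  fuel′ : k + 2 ≤ f + suc q
  fuel′ = ≤-trans (+-monoˡ-≤ 2 (m≤n*m k q)) (m≤m+n f (suc q))

μ-least-square : ∀ q m → 2 ≤ q → q Rough m → 1 ≤ m → q * q ∣ m → μ m ≡ + 0
μ-least-square q m@(suc _) 2≤q r 1≤m q²∣m =
  trans (sym (μ-go-correct (suc f) m q 2≤q r 1≤m fuel)) (μ-go-square f m q 1<m q²∣m)
  where
  f = m + 2
  1<m : 1 < m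
  1<m = ≤-trans 2≤q (∣⇒≤ (m*n∣⇒m∣ q q q²∣m))
  fuel : m + 2 ≤ suc f + q
  fuel = ≤-trans (n≤1+n _) (m≤m+n (suc f) q)

least-divisor : ∀ n → 1 < n → Σ ℕ λ q → 2 ≤ q × q Rough n × q ∣ n
least-divisor n 1<n = search n 2 (m≤m+n n 2) ≤-refl 2-rough
  where
  search : ∀ t m → n ≤ t + m → 2 ≤ m → m Rough n → Σ ℕ λ q → 2 ≤ q × q Rough n × q ∣ n
  search t m h 2≤m r with m ∣? n
  ... | yes m∣n = m , 2≤m , r , m∣n
  search zero    m h 2≤m r | no m∤n =
    ⊥-elim (m∤n (subst (_∣ n) (≤-antisym h (rough-≤ 1<n r)) ∣-refl))
  search (suc t) m h 2≤m r | no m∤n =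
    search t (suc m) (≤-trans h (≤-reflexive (sym (+-suc t m)))) (m≤n⇒m≤1+n 2≤m) (∤⇒rough-suc m∤n r)

least-divisor-prime : ∀ {q n} → 2 ≤ q → q Rough n → q ∣ n → Prime q
least-divisor-prime 2≤q r q∣n = rough∧∣⇒prime {{n>1⇒nonTrivial 2≤q}} r q∣n

prime≥2 : ∀ {p} → Prime p → 2 ≤ p
prime≥2 {suc (suc _)} _ = s≤s (s≤s z≤n)
prime≥2 {zero}        pP = contradiction pP ¬prime[0]
prime≥2 {suc zero}    pP = contradiction pP ¬prime[1]

prime-divisor : ∀ {p q} → Prime p → 2 ≤ q → q ∣ p → q ≡ p
prime-divisor {p} {q} pP 2≤q q∣p with m≤n⇒m<n∨m≡n (∣⇒≤ {{prime⇒nonZero pP}} q∣p)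
... | inj₂ q≡p = q≡p
... | inj₁ q<p = ⊥-elim (Prime.notComposite pP (hasNonTrivialDivisor {{n>1⇒nonTrivial 2≤q}} q<p q∣p))

prime²-cancel : ∀ {p q k} → Prime p → ¬ p ∣ q → p * p ∣ q * k → p * p ∣ k
prime²-cancel {p} {q} {k} pP p∤q h with euclidsLemma q k pP (∣-trans (m∣m*n p) h)
... | inj₁ p∣q = contradiction p∣q p∤q
... | inj₂ (divides k₁ refl) with euclidsLemma q k₁ pP
        (*-cancelʳ-∣ p {{prime⇒nonZero pP}} (subst (p * p ∣_) (sym (*-assoc q k₁ p)) h))
...   | inj₁ p∣q  = contradiction p∣q p∤q
...   | inj₂ p∣k₁ = *-monoˡ-∣ p p∣k₁

positive-factor : ∀ m n → 1 ≤ m * n → 1 ≤ m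
positive-factor (suc _) _ _ = s≤s z≤n

-- μ n = 0 when a prime square divides n (recursion on a bound t ≥ n,
-- removing the least prime factor of n).
μ-square-below : ∀ t {p n} → n ≤ t → Prime p → 1 ≤ n → p * p ∣ n → μ n ≡ + 0
μ-square-below zero    n≤0 _ 1≤n _ = ⊥-elim (<⇒≱ 1≤n n≤0)
μ-square-below (suc t) {p} {n} n≤t pP 1≤n p²∣n with least-divisor n 1<n
  where
  1<n : 1 < n
  1<n = ≤-trans (prime≥2 pP) (∣⇒≤ {{>-nonZero 1≤n}} (m*n∣⇒m∣ p p p²∣n))
... | q , 2≤q , r , q∣n with (q * q) ∣? n
...   | yes q²∣n = μ-least-square q n 2≤q r 1≤n q²∣n
...   | no  q²∤n with q∣n
...     | divides k refl = begin
  μ (k * q)    ≡⟨ cong μ (*-comm k q) ⟩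
  μ (q * k)    ≡⟨ μ-least-simple q k 2≤q (subst (q Rough_) (*-comm k q) r) 1≤k q∤k ⟩
  ℤ.- μ k      ≡⟨ cong ℤ.-_ μk≡0 ⟩
  + 0          ∎
  where
  open ≡-Reasoning
  1≤k : 1 ≤ k
  1≤k = positive-factor k q 1≤n
  q∤k : ¬ q ∣ k
  q∤k q∣k = q²∤n (subst (q * q ∣_) (*-comm q k) (*-monoʳ-∣ q q∣k))
  p∤q : ¬ p ∣ q
  p∤q p∣q with prime-divisor (least-divisor-prime 2≤q r q∣n) (prime≥2 pP) p∣q
  ... | refl = q²∤n p²∣n
  μk≡0 : μ k ≡ + 0
  μk≡0 = μ-square-below t (≤-pred (≤-trans (m<m*n k q {{>-nonZero 1≤k}} 2≤q) n≤t)) pP 1≤k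
                        (prime²-cancel pP p∤q (subst (p * p ∣_) (*-comm k q) p²∣n))

μ-square : ∀ {p n} → Prime p → 1 ≤ n → p * p ∣ n → μ n ≡ + 0
μ-square = μ-square-below _ ≤-refl

-- μ (p·k) = −μ k for a prime p ∤ k (recursion on a bound t ≥ k,
-- removing the least prime factor q of p·k when q ≠ p).
μ-prime-below : ∀ t {p k} → k ≤ t → Prime p → 1 ≤ k → ¬ p ∣ k → μ (p * k) ≡ ℤ.- μ k
μ-prime-below zero    k≤0 _ 1≤k _ = ⊥-elim (<⇒≱ 1≤k k≤0)
μ-prime-below (suc t) {p} {k} k≤t pP 1≤k p∤k with least-divisor (p * k) 1<pk
  where
  1<pk : 1 < p * k
  1<pk = ≤-trans (prime≥2 pP) (m≤m*n p k {{>-nonZero 1≤k}})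
... | q , 2≤q , r , q∣pk with q ≟ p
...   | yes refl = μ-least-simple q k 2≤q r 1≤k p∤k
...   | no  q≢p = other-factor
  where
  qP : Prime q
  qP = least-divisor-prime 2≤q r q∣pk
  q∤p : ¬ q ∣ p
  q∤p q∣p = q≢p (prime-divisor pP 2≤q q∣p)
  q∣k : q ∣ k
  q∣k with euclidsLemma p k qP q∣pk
  ... | inj₁ q∣p = contradiction q∣p q∤p
  ... | inj₂ q∣k = q∣k
  other-factor : μ (p * k) ≡ ℤ.- μ k
  other-factor with (q * q) ∣? (p * k) | q∣k
  ... | yes q²∣pk | _ = begin
    μ (p * k)   ≡⟨ μ-least-square q (p * k) 2≤q r (≤-trans 1≤k (m≤n*m k p {{prime⇒nonZero pP}})) q²∣pk ⟩
    + 0         ≡⟨ cong ℤ.-_ (sym (μ-square qP 1≤k (prime²-cancel qP q∤p q²∣pk))) ⟩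
    ℤ.- μ k     ∎
    where open ≡-Reasoning
  ... | no  q²∤pk | divides k₁ refl = begin
    μ (p * (k₁ * q))      ≡⟨ cong μ reassoc ⟩
    μ (q * (p * k₁))      ≡⟨ μ-least-simple q (p * k₁) 2≤q (subst (q Rough_) reassoc r)
                               (≤-trans 1≤k₁ (m≤n*m k₁ p {{prime⇒nonZero pP}}))
                               (λ q∣pk₁ → q²∤pk (subst (q * q ∣_) (sym reassoc) (*-monoʳ-∣ q q∣pk₁))) ⟩
    ℤ.- μ (p * k₁)        ≡⟨ cong ℤ.-_ (μ-prime-below t k₁≤t pP 1≤k₁ (λ p∣k₁ → p∤k (∣m⇒∣m*n q p∣k₁))) ⟩
    ℤ.- (ℤ.- μ k₁)        ≡⟨ cong ℤ.-_ (sym μqk₁) ⟩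
    ℤ.- μ (k₁ * q)        ∎
    where
    open ≡-Reasoning
    reassoc : p * (k₁ * q) ≡ q * (p * k₁)
    reassoc = trans (sym (*-assoc p k₁ q)) (*-comm (p * k₁) q)
    1≤k₁ : 1 ≤ k₁
    1≤k₁ = positive-factor k₁ q 1≤k
    k₁≤t : k₁ ≤ t
    k₁≤t = ≤-pred (≤-trans (m<m*n k₁ q {{>-nonZero 1≤k₁}} 2≤q) k≤t)
    qk₁∣pk : q * k₁ ∣ p * (k₁ * q)
    qk₁∣pk = subst (_∣ p * (k₁ * q)) (*-comm k₁ q) (n∣m*n p)
    μqk₁ : μ (k₁ * q) ≡ ℤ.- μ k₁
    μqk₁ = trans (cong μ (*-comm k₁ q))
             (μ-least-simple q k₁ 2≤q (rough∧∣⇒rough r qk₁∣pk) 1≤k₁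
                (λ q∣k₁ → q²∤pk (∣-trans (*-monoʳ-∣ q q∣k₁) qk₁∣pk)))

μ-prime : ∀ {p k} → Prime p → 1 ≤ k → ¬ p ∣ k → μ (p * k) ≡ ℤ.- μ k
μ-prime = μ-prime-below _ ≤-refl

-- Sums Σ_{k=1}^n f k, taken over the interval [1, n] listed downwards
-- (the order in which c-sum of Defs accumulates its terms).
interval : ℕ → List ℕ
interval = applyDownFrom suc

sumTo : ℕ → (ℕ → ℤ) → ℤ
sumTo n = ∑ℤ.fold (interval n)

interval-bounds : ∀ n → All (λ k → 1 ≤ k × k ≤ n) (interval n)
interval-bounds zero    = []
interval-bounds (suc n) =
  (s≤s z≤n , ≤-refl) ∷ All.map (λ (1≤k , k≤n) → 1≤k , m≤n⇒m≤1+n k≤n) (interval-bounds n)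

sumTo-cong : ∀ n {f g : ℕ → ℤ} → (∀ {k} → 1 ≤ k → k ≤ n → f k ≡ g k) → sumTo n f ≡ sumTo n g
sumTo-cong n eq = ∑ℤ.fold-cong (interval-bounds n) (λ (1≤k , k≤n) → eq 1≤k k≤n)

sumTo-zero : ∀ n {f : ℕ → ℤ} → (∀ {k} → 1 ≤ k → k ≤ n → f k ≡ + 0) → sumTo n f ≡ + 0
sumTo-zero n eq = trans (sumTo-cong n eq) (∑ℤ.fold-ε (interval n))

interval-+ : ∀ a b → interval (a + b) ≡ map (λ i → b + i) (interval a) ++ interval b
interval-+ zero    b = refl
interval-+ (suc a) b = cong₂ _∷_ (trans (cong suc (+-comm a b)) (sym (+-suc b a))) (interval-+ a b)

sumTo-split : ∀ a b (f : ℕ → ℤ) → sumTo (a + b) f ≡ sumTo a (λ i → f (b + i)) ℤ.+ sumTo b f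
sumTo-split a b f = begin
  sumTo (a + b) f                                          ≡⟨ cong (λ is → ∑ℤ.fold is f) (interval-+ a b) ⟩
  ∑ℤ.fold (map (λ i → b + i) (interval a) ++ interval b) f  ≡⟨ ∑ℤ.fold-++ (map (λ i → b + i) (interval a)) (interval b) f ⟩
  ∑ℤ.fold (map (λ i → b + i) (interval a)) f ℤ.+ sumTo b f  ≡⟨ cong (ℤ._+ sumTo b f) (∑ℤ.fold-map (λ i → b + i) (interval a) f) ⟩
  sumTo a (λ i → f (b + i)) ℤ.+ sumTo b f                  ∎
  where open ≡-Reasoning

sumTo-beyond : ∀ {M N} (f : ℕ → ℤ) → M ≤ N → (∀ {k} → M < k → f k ≡ + 0) → sumTo N f ≡ sumTo M f
sumTo-beyond {M} {N} f M≤N vanish = begin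
  sumTo N f                                       ≡⟨ cong (λ n → sumTo n f) (sym (m∸n+n≡m M≤N)) ⟩
  sumTo (N ∸ M + M) f                             ≡⟨ sumTo-split (N ∸ M) M f ⟩
  sumTo (N ∸ M) (λ i → f (M + i)) ℤ.+ sumTo M f   ≡⟨ cong (ℤ._+ sumTo M f) (sumTo-zero (N ∸ M) (λ 1≤i _ → vanish (m<m+n M 1≤i))) ⟩
  + 0 ℤ.+ sumTo M f                               ≡⟨ ℤP.+-identityˡ _ ⟩
  sumTo M f                                       ∎
  where open ≡-Reasoning

sumTo-multiples : ∀ p M (f : ℕ → ℤ) → 1 ≤ p →
  sumTo (p * M) (λ k → if ⌊ p ∣? k ⌋ then f k else + 0) ≡ sumTo M (λ j → f (p * j))
sumTo-multiples p zero f _ = cong (λ n → sumTo n (λ k → if ⌊ p ∣? k ⌋ then f k else + 0)) (*-zeroʳ p)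
sumTo-multiples p@(suc p₀) (suc M) f _ = begin
  sumTo (p * suc M) g                                  ≡⟨ cong (λ n → sumTo n g) (*-suc p M) ⟩
  sumTo (p + p * M) g                                  ≡⟨ sumTo-split p (p * M) g ⟩
  sumTo p (λ i → g (p * M + i)) ℤ.+ sumTo (p * M) g    ≡⟨ cong₂ ℤ._+_ last-block (sumTo-multiples p M f (s≤s z≤n)) ⟩
  f (p * suc M) ℤ.+ sumTo M (λ j → f (p * j))          ∎
  where
  open ≡-Reasoning
  g : ℕ → ℤ
  g k = if ⌊ p ∣? k ⌋ then f k else + 0
  pM+p≡pM₊ : p * M + p ≡ p * suc M
  pM+p≡pM₊ = trans (+-comm (p * M) p) (sym (*-suc p M))
  top : g (p * M + p) ≡ f (p * suc M)
  top with p ∣? (p * M + p)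
  ... | yes _   = cong f pM+p≡pM₊
  ... | no  p∤  = contradiction (subst (p ∣_) (sym pM+p≡pM₊) (m∣m*n (suc M))) p∤
  inner : ∀ {i} → 1 ≤ i → i ≤ p₀ → g (p * M + i) ≡ + 0
  inner {i} 1≤i i≤p₀ with p ∣? (p * M + i)
  ... | no  _     = refl
  ... | yes p∣pMi = contradiction (∣⇒≤ {{>-nonZero 1≤i}} (∣m+n∣m⇒∣n p∣pMi (m∣m*n M))) (<⇒≱ (s≤s i≤p₀))
  last-block : sumTo p (λ i → g (p * M + i)) ≡ f (p * suc M)
  last-block = trans (cong₂ ℤ._+_ top (sumTo-zero p₀ inner)) (ℤP.+-identityʳ _)

divisorμ : ℕ → ℕ → ℤ
divisorμ q k = if ⌊ k ∣? q ⌋ then μ k else + 0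

divisorμ-beyond : ∀ {q k} → 1 ≤ q → q < k → divisorμ q k ≡ + 0
divisorμ-beyond {q} {k} 1≤q q<k with k ∣? q
... | yes k∣q = contradiction (∣⇒≤ {{>-nonZero 1≤q}} k∣q) (<⇒≱ q<k)
... | no  _   = refl

prime-mul-∣ : ∀ {p j q} → Prime p → ¬ p ∣ j → p ∣ q → j ∣ q → p * j ∣ q
prime-mul-∣ {p} {j} pP p∤j p∣q (divides a refl) with euclidsLemma a j pP p∣q
... | inj₂ p∣j = contradiction p∣j p∤j
... | inj₁ (divides b refl) = divides b (*-assoc b p j)

-- The fundamental identity Σ_{k ∣ q} μ k = [q = 1].  For q > 1 with least
-- prime factor p, the divisors p·j (p ∤ j) cancel the divisors j, and
-- divisors divisible by p² contribute 0.
möbius-sum : ∀ q B → 1 ≤ q → q ≤ B → sumTo B (divisorμ q) ≡ + δ q 1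
möbius-sum (suc zero) B _ 1≤B = sumTo-beyond (divisorμ 1) 1≤B (divisorμ-beyond (s≤s z≤n))
möbius-sum q@(suc (suc _)) B 1≤q q≤B with least-divisor q (s≤s (s≤s z≤n))
... | p , 2≤p , r , p∣q = begin
  sumTo B h                                        ≡⟨ sumTo-beyond h q≤B (divisorμ-beyond 1≤q) ⟩
  sumTo q h                                        ≡⟨ sym (sumTo-beyond h q≤pq (divisorμ-beyond 1≤q)) ⟩
  sumTo (p * q) h                                  ≡⟨ sumTo-cong (p * q) (λ {k} _ _ → split k) ⟩
  sumTo (p * q) (λ k → mult k ℤ.+ rest k)          ≡⟨ ∑ℤ.fold-∙ (interval (p * q)) mult rest ⟩
  sumTo (p * q) mult ℤ.+ sumTo (p * q) rest        ≡⟨ cong (ℤ._+ sumTo (p * q) rest) multiples-cancel ⟩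
  ℤ.- sumTo (p * q) rest ℤ.+ sumTo (p * q) rest    ≡⟨ ℤP.+-inverseˡ (sumTo (p * q) rest) ⟩
  + 0                                              ∎
  where
  open ≡-Reasoning
  h = divisorμ q
  pP : Prime p
  pP = least-divisor-prime 2≤p r p∣q
  1≤p : 1 ≤ p
  1≤p = ≤-trans (s≤s z≤n) 2≤p
  q≤pq : q ≤ p * q
  q≤pq = m≤n*m q p {{>-nonZero 1≤p}}
  mult rest : ℕ → ℤ
  mult k = if ⌊ p ∣? k ⌋ then h k else + 0
  rest k = if ⌊ p ∣? k ⌋ then + 0 else h k
  split : ∀ k → h k ≡ mult k ℤ.+ rest k
  split k with p ∣? k
  ... | yes _ = sym (ℤP.+-identityʳ _)
  ... | no  _ = sym (ℤP.+-identityˡ _)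
  rest-beyond : ∀ {k} → q < k → rest k ≡ + 0
  rest-beyond {k} q<k with p ∣? k
  ... | yes _ = refl
  ... | no  _ = divisorμ-beyond 1≤q q<k
  multiple : ∀ {j} → 1 ≤ j → j ≤ q → h (p * j) ≡ ℤ.- rest j
  multiple {j} 1≤j _ with p ∣? j
  ... | yes p∣j = divisorμ-square
    where
    divisorμ-square : h (p * j) ≡ + 0
    divisorμ-square with (p * j) ∣? q
    ... | yes _ = μ-square pP (≤-trans 1≤j (m≤n*m j p {{>-nonZero 1≤p}})) (*-monoʳ-∣ p p∣j)
    ... | no  _ = refl
  ... | no  p∤j with (p * j) ∣? q | j ∣? q
  ...   | yes _    | yes _   = μ-prime pP 1≤j p∤j
  ...   | yes pj∣q | no  j∤q = contradiction (∣-trans (n∣m*n p) pj∣q) j∤q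
  ...   | no  pj∤q | yes j∣q = contradiction (prime-mul-∣ pP p∤j p∣q j∣q) pj∤q
  ...   | no  _    | no  _   = refl
  multiples-cancel : sumTo (p * q) mult ≡ ℤ.- sumTo (p * q) rest
  multiples-cancel = begin
    sumTo (p * q) mult                  ≡⟨ sumTo-multiples p q h 1≤p ⟩
    sumTo q (λ j → h (p * j))           ≡⟨ sumTo-cong q multiple ⟩
    sumTo q (λ j → ℤ.- rest j)          ≡⟨ ∑ℤ-neg (interval q) rest ⟩
    ℤ.- sumTo q rest                    ≡⟨ cong ℤ.-_ (sym (sumTo-beyond rest q≤pq rest-beyond)) ⟩
    ℤ.- sumTo (p * q) rest              ∎

-- All sublists of a list: its subsets, when the list is duplicate-free.
subsets : ∀ {A : Set} → List A → List (List A)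
subsets []      = [] ∷ []
subsets (y ∷ Y) = subsets Y ++ map (y ∷_) (subsets Y)

IsSubset : ∀ {A : Set} → List A → List A → Set
IsSubset Y J = Unique J × All (_∈ Y) J

subsets-are-subsets : ∀ {A : Set} (Y : List A) → Unique Y → All (IsSubset Y) (subsets Y)
subsets-are-subsets []      _                   = (AllPairs.[] , []) ∷ []
subsets-are-subsets (y ∷ Y) (y∉ AllPairs.∷ uY) = AllP.++⁺
  (All.map (λ (uJ , J⊆) → uJ , All.map there J⊆) IH)
  (AllP.map⁺ (All.map (λ (uJ , J⊆) → All.map (λ j∈ y≡j → All.lookup y∉ j∈ y≡j) J⊆ AllPairs.∷ uJ ,
                                       here refl ∷ All.map there J⊆) IH))
  where
  IH = subsets-are-subsets Y uY

sign : ℕ → ℤ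
sign zero    = + 1
sign (suc n) = ℤ.- sign n

avoids : List ℕ → ℕ → Bool
avoids Z m = all (λ z → not ⌊ m ∣? z ⌋) Z

avoids⁺ : ∀ Z m → T (avoids Z m) → ∀ {z} → z ∈ Z → ¬ m ∣ z
avoids⁺ (z ∷ Z) m h (here refl) m∣z with m ∣? z
... | no  m∤z = m∤z m∣z
avoids⁺ (z ∷ Z) m h (there z∈) m∣z with m ∣? z
... | no  _ = avoids⁺ Z m h z∈ m∣z

avoids⁻ : ∀ Z m → (∀ {z} → z ∈ Z → ¬ m ∣ z) → T (avoids Z m)
avoids⁻ []      m _ = tt
avoids⁻ (z ∷ Z) m h with m ∣? z
... | yes m∣z = h (here refl) m∣z
... | no  _   = avoids⁻ Z m (λ z∈ → h (there z∈))

bool-ext : ∀ {a b : Bool} → (T a → T b) → (T b → T a) → a ≡ b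
bool-ext {false} {false} _ _ = refl
bool-ext {false} {true}  _ g = ⊥-elim (g tt)
bool-ext {true}  {false} f _ = ⊥-elim (f tt)
bool-ext {true}  {true}  _ _ = refl

sieve : ℕ → List ℕ → ℕ → ℕ → ℤ
sieve X Z M d = sumTo X (λ k → if avoids Z (k * d) ∧ ⌊ k * d ∣? M ⌋ then μ k else + 0)

exclude : ∀ a A b (x : ℤ) →
  (if (not a ∧ A) ∧ b then x else + 0) ≡ (if A ∧ b then x else + 0) ℤ.- (if A ∧ (b ∧ a) then x else + 0)
exclude true  true  true  x = sym (ℤP.+-inverseʳ x)
exclude true  true  false x = refl
exclude true  false b     x = refl
exclude false true  true  x = sym (ℤP.+-identityʳ x)
exclude false true  false x = refl
exclude false false b     x = refl

∣gcd? : ∀ m M z → ⌊ m ∣? gcd M z ⌋ ≡ ⌊ m ∣? M ⌋ ∧ ⌊ m ∣? z ⌋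
∣gcd? m M z with m ∣? M | m ∣? z | m ∣? gcd M z
... | yes m∣M | yes m∣z | no  m∤g = contradiction (gcd-greatest m∣M m∣z) m∤g
... | yes _   | no  m∤z | yes m∣g = contradiction (∣-trans m∣g (gcd[m,n]∣n M z)) m∤z
... | no  m∤M | _       | yes m∣g = contradiction (∣-trans m∣g (gcd[m,n]∣m M z)) m∤M
... | yes _   | yes _   | yes _   = refl
... | yes _   | no  _   | no  _   = refl
... | no  _   | _       | no  _   = refl

-- Ceasing to avoid z: the multiples k·d ∣ M that divide z are those dividing gcd M z.
sieve-step : ∀ X z Z M d → sieve X (z ∷ Z) M d ≡ sieve X Z M d ℤ.- sieve X Z (gcd M z) d
sieve-step X z Z M d = begin
  sieve X (z ∷ Z) M d                                   ≡⟨ ∑ℤ.fold-ext (interval X) pointwise ⟩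
  sumTo X (λ k → term M k ℤ.+ ℤ.- term (gcd M z) k)     ≡⟨ ∑ℤ.fold-∙ (interval X) (term M) _ ⟩
  sieve X Z M d ℤ.+ sumTo X (λ k → ℤ.- term (gcd M z) k) ≡⟨ cong (λ t → sieve X Z M d ℤ.+ t) (∑ℤ-neg (interval X) (term (gcd M z))) ⟩
  sieve X Z M d ℤ.- sieve X Z (gcd M z) d               ∎
  where
  open ≡-Reasoning
  term : ℕ → ℕ → ℤ
  term M₀ k = if avoids Z (k * d) ∧ ⌊ k * d ∣? M₀ ⌋ then μ k else + 0
  pointwise : ∀ k → _ ≡ term M k ℤ.+ ℤ.- term (gcd M z) k
  pointwise k = trans (exclude ⌊ k * d ∣? z ⌋ (avoids Z (k * d)) ⌊ k * d ∣? M ⌋ (μ k))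
    (cong (λ b → term M k ℤ.- (if avoids Z (k * d) ∧ b then μ k else + 0)) (sym (∣gcd? (k * d) M z)))

sieve-expand : ∀ X Z M d →
  sieve X Z M d ≡ ∑ℤ.fold (subsets Z) (λ J → sign (length J) ℤ.* sieve X [] (gcd M (gcdList J)) d)
sieve-expand X [] M d =
  sym (trans (ℤP.+-identityʳ _) (trans (ℤP.*-identityˡ _) (cong (λ m → sieve X [] m d) (gcd-identityʳ M))))
sieve-expand X (z ∷ Z) M d = begin
  sieve X (z ∷ Z) M d                                     ≡⟨ sieve-step X z Z M d ⟩
  sieve X Z M d ℤ.- sieve X Z (gcd M z) d                 ≡⟨ cong₂ ℤ._-_ (sieve-expand X Z M d) (sieve-expand X Z (gcd M z) d) ⟩
  ∑ℤ.fold (subsets Z) (term M) ℤ.- ∑ℤ.fold (subsets Z) (term (gcd M z))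
                                                          ≡⟨ cong (λ t → ∑ℤ.fold (subsets Z) (term M) ℤ.+ t) (sym with-z) ⟩
  ∑ℤ.fold (subsets Z) (term M) ℤ.+ ∑ℤ.fold (map (z ∷_) (subsets Z)) (term M)
                                                          ≡⟨ sym (∑ℤ.fold-++ (subsets Z) _ (term M)) ⟩
  ∑ℤ.fold (subsets (z ∷ Z)) (term M)                      ∎
  where
  open ≡-Reasoning
  term : ℕ → List ℕ → ℤ
  term M₀ J = sign (length J) ℤ.* sieve X [] (gcd M₀ (gcdList J)) d
  with-z : ∑ℤ.fold (map (z ∷_) (subsets Z)) (term M) ≡ ℤ.- ∑ℤ.fold (subsets Z) (term (gcd M z))
  with-z = begin
    ∑ℤ.fold (map (z ∷_) (subsets Z)) (term M)         ≡⟨ ∑ℤ.fold-map (z ∷_) (subsets Z) (term M) ⟩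
    ∑ℤ.fold (subsets Z) (λ J → term M (z ∷ J))        ≡⟨ ∑ℤ.fold-ext (subsets Z) flip-sign ⟩
    ∑ℤ.fold (subsets Z) (λ J → ℤ.- term (gcd M z) J) ≡⟨ ∑ℤ-neg (subsets Z) (term (gcd M z)) ⟩
    ℤ.- ∑ℤ.fold (subsets Z) (term (gcd M z))          ∎
    where
    flip-sign : ∀ J → term M (z ∷ J) ≡ ℤ.- term (gcd M z) J
    flip-sign J = trans (sym (ℤP.neg-distribˡ-* (sign (length J)) _))
      (cong (λ m → ℤ.- (sign (length J) ℤ.* sieve X [] m d)) (sym (gcd-assoc M z (gcdList J))))

gcd-positive : ∀ m n → 1 ≤ m → 1 ≤ gcd m n
gcd-positive m n 1≤m = n≢0⇒n>0 (gcd[m,n]≢0 m n (inj₁ (λ m≡0 → <⇒≢ 1≤m (sym m≡0))))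

-- Without sieving only Σ_{k·d ∣ M} μ k remains, which is [M = d] by
-- the Möbius identity.
sieve-empty : ∀ X M d → 1 ≤ M → M ≤ X → 1 ≤ d → sieve X [] M d ≡ + δ M d
sieve-empty X M d 1≤M M≤X 1≤d with d ∣? M
... | no d∤M = trans (sumTo-zero X vanish) (cong +_ (sym δ≡0))
  where
  vanish : ∀ {k} → 1 ≤ k → k ≤ X → (if ⌊ k * d ∣? M ⌋ then μ k else + 0) ≡ + 0
  vanish {k} _ _ with (k * d) ∣? M
  ... | yes kd∣M = contradiction (∣-trans (n∣m*n k) kd∣M) d∤M
  ... | no  _    = refl
  δ≡0 : δ M d ≡ 0
  δ≡0 with M ≟ d
  ... | yes refl = contradiction ∣-refl d∤M
  ... | no  _    = refl
... | yes (divides q refl) =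
  trans (sumTo-cong X cancel-d) (trans (möbius-sum q X 1≤q q≤X) (cong +_ δ-cancel))
  where
  instance
    d≢0 : NonZero d
    d≢0 = >-nonZero 1≤d
  1≤q : 1 ≤ q
  1≤q = positive-factor q d 1≤M
  q≤X : q ≤ X
  q≤X = ≤-trans (m≤m*n q d) M≤X
  cancel-d : ∀ {k} → 1 ≤ k → k ≤ X → (if ⌊ k * d ∣? q * d ⌋ then μ k else + 0) ≡ divisorμ q k
  cancel-d {k} _ _ with (k * d) ∣? (q * d) | k ∣? q
  ... | yes _     | yes _   = refl
  ... | yes kd∣qd | no  k∤q = contradiction (*-cancelʳ-∣ d kd∣qd) k∤q
  ... | no  kd∤qd | yes k∣q = contradiction (*-monoˡ-∣ d k∣q) kd∤qd
  ... | no  _     | no  _   = refl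
  δ-cancel : δ q 1 ≡ δ (q * d) d
  δ-cancel with q ≟ 1 | (q * d) ≟ d
  ... | yes _    | yes _    = refl
  ... | yes refl | no  qd≢d = contradiction (*-identityˡ d) qd≢d
  ... | no  q≢1  | yes qd≡d = contradiction (*-cancelʳ-≡ q 1 d (trans qd≡d (sym (*-identityˡ d)))) q≢1
  ... | no  _    | no  _    = refl

sieve-formula : ∀ X Z M d → 1 ≤ M → M ≤ X → 1 ≤ d →
  sieve X Z M d ≡ ∑ℤ.fold (subsets Z) (λ J → sign (length J) ℤ.* + δ (gcd M (gcdList J)) d)
sieve-formula X Z M d 1≤M M≤X 1≤d = trans (sieve-expand X Z M d) (∑ℤ.fold-ext (subsets Z) unsieved)
  where
  unsieved : ∀ J → sign (length J) ℤ.* sieve X [] (gcd M (gcdList J)) d ≡ sign (length J) ℤ.* + δ (gcd M (gcdList J)) d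
  unsieved J = cong (sign (length J) ℤ.*_)
    (sieve-empty X (gcd M (gcdList J)) d (gcd-positive M _ 1≤M)
       (≤-trans (∣⇒≤ {{>-nonZero 1≤M}} (gcd[m,n]∣m M (gcdList J))) M≤X) 1≤d)

-- Subsets are weighted by their size through functions ℕ → ℕ: the
-- parity indicators, and the indicators of size 0, size 1, and of the
-- even and odd sizes ≥ 2.
mutual
  isEven : ℕ → ℕ
  isEven zero    = 1
  isEven (suc n) = isOdd n

  isOdd : ℕ → ℕ
  isOdd zero    = 0
  isOdd (suc n) = isEven n

isZero isOne evenAbove1 oddAbove1 : ℕ → ℕ
isZero zero    = 1
isZero (suc _) = 0
isOne zero     = 0
isOne (suc n)  = isZero n
evenAbove1 zero    = 0
evenAbove1 (suc n) = isOdd n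
oddAbove1 zero     = 0
oddAbove1 (suc n)  = evenAbove1 n

even-split : ∀ n → isEven n ≡ isZero n + evenAbove1 n
even-split zero    = refl
even-split (suc n) = refl

odd-split : ∀ n → isOdd n ≡ isOne n + oddAbove1 n
odd-split zero    = refl
odd-split (suc n) = even-split n

sign-split : ∀ n a → sign n ℤ.* + a ≡ + (isEven n * a) ℤ.- + (isOdd n * a)
sign-split zero    a =
  trans (ℤP.*-identityˡ (+ a)) (trans (cong +_ (sym (+-identityʳ a))) (sym (ℤP.+-identityʳ _)))
sign-split (suc n) a = begin
  ℤ.- sign n ℤ.* + a                                 ≡⟨ sym (ℤP.neg-distribˡ-* (sign n) (+ a)) ⟩
  ℤ.- (sign n ℤ.* + a)                               ≡⟨ cong ℤ.-_ (sign-split n a) ⟩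
  ℤ.- (+ (isEven n * a) ℤ.- + (isOdd n * a))         ≡⟨ negate-difference (+ (isEven n * a)) (+ (isOdd n * a)) ⟩
  + (isOdd n * a) ℤ.- + (isEven n * a)               ∎
  where
  open ≡-Reasoning
  negate-difference : ∀ (x y : ℤ) → ℤ.- (x ℤ.- y) ≡ y ℤ.- x
  negate-difference x y = trans (ℤP.neg-distrib-+ x (ℤ.- y))
    (trans (cong (λ t → ℤ.- x ℤ.+ t) (ℤP.neg-involutive y)) (ℤP.+-comm (ℤ.- x) y))

count : ∀ {A : Set} → (ℕ → ℕ) → List A → ℕ
count w Y = ∑.fold (subsets Y) (λ J → w (length J))

-- Subsets of y ∷ Y either omit y, or contain y and are one larger.
count-∷ : ∀ {A : Set} w (y : A) Y → count w (y ∷ Y) ≡ count w Y + count (λ n → w (suc n)) Y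
count-∷ w y Y = trans (∑.fold-++ (subsets Y) _ (λ J → w (length J)))
                      (cong (λ t → count w Y + t) (∑.fold-map (y ∷_) (subsets Y) (λ J → w (length J))))

count-isZero : ∀ {A : Set} (Y : List A) → count isZero Y ≡ 1
count-isZero []      = refl
count-isZero (y ∷ Y) = trans (count-∷ isZero y Y) (cong₂ _+_ (count-isZero Y) (∑.fold-ε (subsets Y)))

count-isOne : ∀ {A : Set} (Y : List A) → count isOne Y ≡ length Y
count-isOne []      = refl
count-isOne (y ∷ Y) =
  trans (count-∷ isOne y Y) (trans (cong₂ _+_ (count-isOne Y) (count-isZero Y)) (+-comm (length Y) 1))

-- A non-empty set has as many even as odd subsets; so the subsets of
-- size ≥ 2 satisfy  #even + 1 = #odd + |Y|.
count-above1 : ∀ {A : Set} (y : A) Y →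
  count evenAbove1 (y ∷ Y) + 1 ≡ count oddAbove1 (y ∷ Y) + length (y ∷ Y)
count-above1 y Y = begin
  count evenAbove1 Y₊ + 1                   ≡⟨ +-comm _ 1 ⟩
  1 + count evenAbove1 Y₊                   ≡⟨ cong (λ t → t + count evenAbove1 Y₊) (sym (count-isZero Y₊)) ⟩
  count isZero Y₊ + count evenAbove1 Y₊     ≡⟨ sym (∑.fold-∙ (subsets Y₊) _ _) ⟩
  count (λ n → isZero n + evenAbove1 n) Y₊  ≡⟨ ∑.fold-ext (subsets Y₊) (λ J → sym (even-split (length J))) ⟩
  count isEven Y₊                           ≡⟨ count-∷ isEven y Y ⟩
  count isEven Y + count isOdd Y            ≡⟨ +-comm (count isEven Y) _ ⟩
  count isOdd Y + count isEven Y            ≡⟨ sym (count-∷ isOdd y Y) ⟩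
  count isOdd Y₊                            ≡⟨ ∑.fold-ext (subsets Y₊) (λ J → odd-split (length J)) ⟩
  count (λ n → isOne n + oddAbove1 n) Y₊    ≡⟨ ∑.fold-∙ (subsets Y₊) _ _ ⟩
  count isOne Y₊ + count oddAbove1 Y₊       ≡⟨ cong (λ t → t + count oddAbove1 Y₊) (count-isOne Y₊) ⟩
  length Y₊ + count oddAbove1 Y₊            ≡⟨ +-comm (length Y₊) _ ⟩
  count oddAbove1 Y₊ + length Y₊            ∎
  where
  open ≡-Reasoning
  Y₊ = y ∷ Y

-- For v = gcd a (lcm b c), u = lcm (gcd a b) (gcd a c)
-- and γ = gcd (gcd a b) (gcd a c): u ∣ v directly, and v·γ divides
-- gcd a b · gcd a c = γ·u, where γ ≠ 0 may be cancelled when a ≠ 0.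
gcd-lcm-distrib : ∀ a b c → gcd a (lcm b c) ≡ lcm (gcd a b) (gcd a c)
gcd-lcm-distrib zero      b c = trans (gcd-identityˡ (lcm b c)) (cong₂ lcm (sym (gcd-identityˡ b)) (sym (gcd-identityˡ c)))
gcd-lcm-distrib a@(suc _) b c = ∣-antisym v∣u u∣v
  where
  u = lcm (gcd a b) (gcd a c)
  v = gcd a (lcm b c)
  γ = gcd (gcd a b) (gcd a c)
  u∣v : u ∣ v
  u∣v = lcm-least (gcd-greatest (gcd[m,n]∣m a b) (∣-trans (gcd[m,n]∣n a b) (m∣lcm[m,n] b c)))
                  (gcd-greatest (gcd[m,n]∣m a c) (∣-trans (gcd[m,n]∣n a c) (n∣lcm[m,n] b c)))
  v∣a : v ∣ a
  v∣a = gcd[m,n]∣m a (lcm b c)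
  v∣l : v ∣ lcm b c
  v∣l = gcd[m,n]∣n a (lcm b c)
  γ∣ab : γ ∣ gcd a b
  γ∣ab = gcd[m,n]∣m (gcd a b) (gcd a c)
  γ∣ac : γ ∣ gcd a c
  γ∣ac = gcd[m,n]∣n (gcd a b) (gcd a c)
  γ∣a : γ ∣ a
  γ∣a = ∣-trans γ∣ab (gcd[m,n]∣m a b)
  γ∣b : γ ∣ b
  γ∣b = ∣-trans γ∣ab (gcd[m,n]∣n a b)
  γ∣c : γ ∣ c
  γ∣c = ∣-trans γ∣ac (gcd[m,n]∣n a c)
  product-of-gcds : gcd a b * gcd a c ≡ gcd (gcd (a * a) (a * c)) (gcd (b * a) (b * c))
  product-of-gcds = trans (*-comm (gcd a b) (gcd a c)) (trans (c*gcd[m,n]≡gcd[cm,cn] (gcd a c) a b)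
    (cong₂ gcd (trans (*-comm (gcd a c) a) (c*gcd[m,n]≡gcd[cm,cn] a a c))
               (trans (*-comm (gcd a c) b) (c*gcd[m,n]≡gcd[cm,cn] b a c))))
  vγ∣ : v * γ ∣ gcd a b * gcd a c
  vγ∣ = subst (v * γ ∣_) (sym product-of-gcds) (gcd-greatest
    (gcd-greatest (*-pres-∣ v∣a γ∣a) (*-pres-∣ v∣a γ∣c))
    (gcd-greatest (subst (v * γ ∣_) (*-comm a b) (*-pres-∣ v∣a γ∣b))
                  (subst (v * γ ∣_) (trans (*-comm (lcm b c) (gcd b c)) (gcd*lcm b c))
                         (*-pres-∣ v∣l (gcd-greatest γ∣b γ∣c)))))
  v∣u : v ∣ u
  v∣u = *-cancelʳ-∣ γ {{>-nonZero (gcd-positive (gcd a b) (gcd a c) (gcd-positive a b (s≤s z≤n)))}}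
          (subst (v * γ ∣_) (trans (sym (gcd*lcm (gcd a b) (gcd a c))) (*-comm γ u)) vγ∣)

gcd-lcmList : ∀ y Y → gcd y (lcmList Y) ≡ lcmList (map (gcd y) Y)
gcd-lcmList y []      = gcd-zeroʳ y
gcd-lcmList y (z ∷ Y) = trans (gcd-lcm-distrib y z (lcmList Y)) (cong (lcm (gcd y z)) (gcd-lcmList y Y))

gcd-shared : ∀ y a g → gcd (gcd y a) (gcd y g) ≡ gcd y (gcd a g)
gcd-shared y a g = ∣-antisym
  (gcd-greatest (∣-trans l∣ya (gcd[m,n]∣m y a))
     (gcd-greatest (∣-trans l∣ya (gcd[m,n]∣n y a)) (∣-trans l∣yg (gcd[m,n]∣n y g))))
  (gcd-greatest (gcd-greatest (gcd[m,n]∣m y (gcd a g)) (∣-trans r∣ag (gcd[m,n]∣m a g)))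
     (gcd-greatest (gcd[m,n]∣m y (gcd a g)) (∣-trans r∣ag (gcd[m,n]∣n a g))))
  where
  l∣ya = gcd[m,n]∣m (gcd y a) (gcd y g)
  l∣yg = gcd[m,n]∣n (gcd y a) (gcd y g)
  r∣ag = gcd[m,n]∣n y (gcd a g)

gcdList-map : ∀ y a J → gcdList (map (gcd y) (a ∷ J)) ≡ gcd y (gcdList (a ∷ J))
gcdList-map y a []      = trans (gcd-identityʳ (gcd y a)) (cong (gcd y) (sym (gcd-identityʳ a)))
gcdList-map y a (b ∷ J) = trans (cong (gcd (gcd y a)) (gcdList-map y b J)) (gcd-shared y a _)

subsets-map : ∀ {A B : Set} (f : A → B) Y → subsets (map f Y) ≡ map (map f) (subsets Y)
subsets-map f []      = refl
subsets-map f (y ∷ Y) = begin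
  subsets (map f Y) ++ map (f y ∷_) (subsets (map f Y))         ≡⟨ cong (λ S → S ++ map (f y ∷_) S) (subsets-map f Y) ⟩
  map (map f) (subsets Y) ++ map (f y ∷_) (map (map f) (subsets Y))
                                                                ≡⟨ cong (map (map f) (subsets Y) ++_) (sym (map-∘ (subsets Y))) ⟩
  map (map f) (subsets Y) ++ map (λ J → f y ∷ map f J) (subsets Y)
                                                                ≡⟨ cong (map (map f) (subsets Y) ++_) (map-∘ (subsets Y)) ⟩
  map (map f) (subsets Y) ++ map (map f) (map (y ∷_) (subsets Y)) ≡⟨ sym (map-++ (map f) (subsets Y) _) ⟩
  map (map f) (subsets (y ∷ Y))                                 ∎
  where open ≡-Reasoning

gcdPower : (ℕ → ℕ) → List ℕ → ℕ
gcdPower w Y = ∏.fold (subsets Y) (λ J → gcdList J ^ w (length J))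

gcdPowerWith : ℕ → (ℕ → ℕ) → List ℕ → ℕ
gcdPowerWith y w Y = ∏.fold (subsets Y) (λ J → gcd y (gcdList J) ^ w (length J))

gcdPower-∷ : ∀ w y Y → gcdPower w (y ∷ Y) ≡ gcdPower w Y * gcdPowerWith y (λ n → w (suc n)) Y
gcdPower-∷ w y Y = trans (∏.fold-++ (subsets Y) _ _)
  (cong (gcdPower w Y *_) (∏.fold-map (y ∷_) (subsets Y) (λ J → gcdList J ^ w (length J))))

-- The subsets of {gcd y z : z ∈ Y} have gcds gcd y (gcd J); the empty
-- subset does not fit this pattern, so it must have weight 0.
gcdPower-map : ∀ w y Y → w 0 ≡ 0 → gcdPower w (map (gcd y) Y) ≡ gcdPowerWith y w Y
gcdPower-map w y Y w0≡0 = begin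
  gcdPower w (map (gcd y) Y)                                           ≡⟨ cong (λ S → ∏.fold S F) (subsets-map (gcd y) Y) ⟩
  ∏.fold (map (map (gcd y)) (subsets Y)) F                             ≡⟨ ∏.fold-map (map (gcd y)) (subsets Y) F ⟩
  ∏.fold (subsets Y) (λ J → F (map (gcd y) J))                         ≡⟨ ∏.fold-ext (subsets Y) termwise ⟩
  gcdPowerWith y w Y                                                   ∎
  where
  open ≡-Reasoning
  F : List ℕ → ℕ
  F J = gcdList J ^ w (length J)
  termwise : ∀ J → F (map (gcd y) J) ≡ gcd y (gcdList J) ^ w (length J)
  termwise []      = trans (cong (0 ^_) w0≡0) (cong (gcd y 0 ^_) (sym w0≡0))
  termwise (a ∷ J) = cong₂ _^_ (gcdList-map y a J) (cong w (length-map (gcd y) (a ∷ J)))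

-- Only the empty subset has size 0; its gcd with y is y.
gcdPowerWith-isZero : ∀ y Y → gcdPowerWith y isZero Y ≡ y
gcdPowerWith-isZero y []      = trans (*-identityʳ _) (trans (*-identityʳ _) (gcd-identityʳ y))
gcdPowerWith-isZero y (z ∷ Y) = trans (∏.fold-++ (subsets Y) _ _)
  (trans (cong₂ _*_ (gcdPowerWith-isZero y Y)
                    (trans (∏.fold-map (z ∷_) (subsets Y) _) (∏.fold-ε (subsets Y))))
         (*-identityʳ y))

gcdPowerWith-+ : ∀ y Y w w′ → gcdPowerWith y (λ n → w n + w′ n) Y ≡ gcdPowerWith y w Y * gcdPowerWith y w′ Y
gcdPowerWith-+ y Y w w′ =
  trans (∏.fold-ext (subsets Y) (λ J → ^-distribˡ-+-* _ (w (length J)) (w′ (length J)))) (∏.fold-∙ (subsets Y) _ _)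

gcdPower-isOne : ∀ Y → gcdPower isOne Y ≡ product Y
gcdPower-isOne []      = refl
gcdPower-isOne (y ∷ Y) =
  trans (gcdPower-∷ isOne y Y) (trans (cong₂ _*_ (gcdPower-isOne Y) (gcdPowerWith-isZero y Y)) (*-comm (product Y) y))

-- Odd sizes are size 1 or sizes ≥ 3.
gcdPower-odd : ∀ Y → gcdPower isOdd Y ≡ product Y * gcdPower oddAbove1 Y
gcdPower-odd Y = begin
  gcdPower isOdd Y                                 ≡⟨ ∏.fold-ext (subsets Y) (λ J → cong (gcdList J ^_) (odd-split (length J))) ⟩
  ∏.fold (subsets Y) (λ J → gcdList J ^ (isOne (length J) + oddAbove1 (length J)))
                                                   ≡⟨ ∏.fold-ext (subsets Y) (λ J → ^-distribˡ-+-* (gcdList J) (isOne (length J)) _) ⟩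
  ∏.fold (subsets Y) (λ J → gcdList J ^ isOne (length J) * gcdList J ^ oddAbove1 (length J))
                                                   ≡⟨ ∏.fold-∙ (subsets Y) _ _ ⟩
  gcdPower isOne Y * gcdPower oddAbove1 Y          ≡⟨ cong (_* gcdPower oddAbove1 Y) (gcdPower-isOne Y) ⟩
  product Y * gcdPower oddAbove1 Y                 ∎
  where open ≡-Reasoning

-- By induction on |Y|, using lcm y L · gcd y L = y · L for L = lcm Y₀
-- and gcd y L = lcm {gcd y z : z ∈ Y₀}, to which the induction
-- hypothesis applies as well.
lcm-inclusion-exclusion : ∀ Y → lcmList Y * gcdPower evenAbove1 Y ≡ gcdPower isOdd Y
lcm-inclusion-exclusion Y = by-length (length Y) Y refl
  where
  by-length : ∀ n Y → length Y ≡ n → lcmList Y * gcdPower evenAbove1 Y ≡ gcdPower isOdd Y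
  by-length n       []       _      = refl
  by-length (suc n) (y ∷ Y₀) |Y|≡n+1 = begin
    lcm y L * gcdPower evenAbove1 (y ∷ Y₀)                      ≡⟨ cong (lcm y L *_) even-step ⟩
    lcm y L * (gcdPower evenAbove1 Y₀ * gcdPower isOdd Y′)      ≡⟨ cong (λ t → lcm y L * (gcdPower evenAbove1 Y₀ * t)) (sym IH′) ⟩
    lcm y L * (gcdPower evenAbove1 Y₀ * (lcmList Y′ * gcdPower evenAbove1 Y′))
                                                                ≡⟨ cong (λ t → lcm y L * (gcdPower evenAbove1 Y₀ * (t * gcdPower evenAbove1 Y′))) (sym (gcd-lcmList y Y₀)) ⟩
    lcm y L * (gcdPower evenAbove1 Y₀ * (gcd y L * gcdPower evenAbove1 Y′))
                                                                ≡⟨ rearrange (lcm y L) (gcd y L) _ _ y L (gcd*lcm y L) ⟩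
    (L * gcdPower evenAbove1 Y₀) * (y * gcdPower evenAbove1 Y′) ≡⟨ cong (_* (y * gcdPower evenAbove1 Y′)) IH ⟩
    gcdPower isOdd Y₀ * (y * gcdPower evenAbove1 Y′)            ≡⟨ sym odd-step ⟩
    gcdPower isOdd (y ∷ Y₀)                                     ∎
    where
    open ≡-Reasoning
    L  = lcmList Y₀
    Y′ = map (gcd y) Y₀
    IH : L * gcdPower evenAbove1 Y₀ ≡ gcdPower isOdd Y₀
    IH = by-length n Y₀ (suc-injective |Y|≡n+1)
    IH′ : lcmList Y′ * gcdPower evenAbove1 Y′ ≡ gcdPower isOdd Y′
    IH′ = by-length n Y′ (trans (length-map (gcd y) Y₀) (suc-injective |Y|≡n+1))
    even-step : gcdPower evenAbove1 (y ∷ Y₀) ≡ gcdPower evenAbove1 Y₀ * gcdPower isOdd Y′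
    even-step = trans (gcdPower-∷ evenAbove1 y Y₀) (cong (gcdPower evenAbove1 Y₀ *_) (sym (gcdPower-map isOdd y Y₀ refl)))
    odd-step : gcdPower isOdd (y ∷ Y₀) ≡ gcdPower isOdd Y₀ * (y * gcdPower evenAbove1 Y′)
    odd-step = trans (gcdPower-∷ isOdd y Y₀) (cong (gcdPower isOdd Y₀ *_) (begin
      gcdPowerWith y isEven Y₀                                      ≡⟨ ∏.fold-ext (subsets Y₀) (λ J → cong (gcd y (gcdList J) ^_) (even-split (length J))) ⟩
      gcdPowerWith y (λ n → isZero n + evenAbove1 n) Y₀             ≡⟨ gcdPowerWith-+ y Y₀ isZero evenAbove1 ⟩
      gcdPowerWith y isZero Y₀ * gcdPowerWith y evenAbove1 Y₀       ≡⟨ cong₂ _*_ (gcdPowerWith-isZero y Y₀) (sym (gcdPower-map evenAbove1 y Y₀ refl)) ⟩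
      y * gcdPower evenAbove1 Y′                                    ∎))
    rearrange : ∀ l g e e′ y L → g * l ≡ y * L → l * (e * (g * e′)) ≡ (L * e) * (y * e′)
    rearrange l g e e′ y L gl≡yL = trans (regroup l g e e′) (trans (cong (_* (e * e′)) gl≡yL) (spread y L e e′))
      where
      regroup : ∀ l g e e′ → l * (e * (g * e′)) ≡ (g * l) * (e * e′)
      regroup = solve-∀
      spread : ∀ y L e e′ → (y * L) * (e * e′) ≡ (L * e) * (y * e′)
      spread = solve-∀

difference-from-balance : ∀ a b m → 1 ≤ m → a + 1 ≡ b + m → + a ℤ.- + b ≡ + (m ∸ 1)
difference-from-balance a b (suc m) _ a+1≡b+m+1 = begin
  + a ℤ.- + b            ≡⟨ cong (λ t → + t ℤ.- + b) a≡b+m ⟩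
  + (b + m) ℤ.- + b      ≡⟨ cong (ℤ._- + b) (ℤP.pos-+ b m) ⟩
  + b ℤ.+ + m ℤ.- + b    ≡⟨ cancel (+ b) (+ m) ⟩
  + m                    ∎
  where
  open ≡-Reasoning
  a≡b+m : a ≡ b + m
  a≡b+m = suc-injective (trans (+-comm 1 a) (trans a+1≡b+m+1 (+-suc b m)))
  cancel : ∀ x y → x ℤ.+ y ℤ.- x ≡ y
  cancel = ℤ-solve-∀

pos-neg-balance : ∀ z a b → z ≡ + a ℤ.- + b → pos z + b ≡ neg z + a
pos-neg-balance (+ n)      a b z≡a-b = ℤP.+-injective (begin
  + (n + b)              ≡⟨ ℤP.pos-+ n b ⟩
  + n ℤ.+ + b            ≡⟨ cong (ℤ._+ + b) z≡a-b ⟩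
  + a ℤ.- + b ℤ.+ + b    ≡⟨ cancel (+ a) (+ b) ⟩
  + a                    ∎)
  where
  open ≡-Reasoning
  cancel : ∀ x y → x ℤ.- y ℤ.+ y ≡ x
  cancel = ℤ-solve-∀
pos-neg-balance -[1+ n ]   a b z≡a-b = ℤP.+-injective (begin
  + b                                   ≡⟨ sym (ℤP.+-identityˡ (+ b)) ⟩
  + 0 ℤ.+ + b                           ≡⟨ cong (ℤ._+ + b) (sym (ℤP.+-inverseʳ (+ suc n))) ⟩
  + suc n ℤ.+ -[1+ n ] ℤ.+ + b          ≡⟨ cong (λ t → + suc n ℤ.+ t ℤ.+ + b) z≡a-b ⟩
  + suc n ℤ.+ (+ a ℤ.- + b) ℤ.+ + b     ≡⟨ regroup (+ suc n) (+ a) (+ b) ⟩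
  + suc n ℤ.+ + a                       ≡⟨ sym (ℤP.pos-+ (suc n) a) ⟩
  + (suc n + a)                         ∎)
  where
  open ≡-Reasoning
  regroup : ∀ x y z → x ℤ.+ (y ℤ.- z) ℤ.+ z ≡ x ℤ.+ y
  regroup = ℤ-solve-∀

module GreatestTypeDivisors
  (S : List ℕ) (S-pos : All (λ x → 0 < x) S) (S-closed : GcdClosed S)
  (X : ℕ) (X∈S : X ∈ S)
  (ys : List ℕ) (ys-unique : Unique ys) (ys-spec : ∀ y → (y ∈ ys) ⇔ IsGreatestTypeDivisor S y X)
  (ds : List ℕ) (ds-unique : Unique ds) (ds-spec : ∀ d → (d ∈ ds) ⇔ InD ys d) where

  X-pos : 0 < X
  X-pos = All.lookup S-pos X∈S

  greatest : ∀ {y} → y ∈ ys → IsGreatestTypeDivisor S y X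
  greatest y∈ = Equivalence.to (ys-spec _) y∈

  y∈S : ∀ {y} → y ∈ ys → y ∈ S
  y∈S y∈ = proj₁ (greatest y∈)

  y<X : ∀ {y} → y ∈ ys → y < X
  y<X y∈ = proj₁ (proj₂ (proj₂ (greatest y∈)))

  y∣X : ∀ {y} → y ∈ ys → y ∣ X
  y∣X y∈ = proj₁ (proj₂ (proj₂ (proj₂ (greatest y∈))))

  y-pos : ∀ {y} → y ∈ ys → 0 < y
  y-pos y∈ = All.lookup S-pos (y∈S y∈)

  -- Every proper divisor g ∈ S of X divides a greatest-type divisor:
  -- climb through elements of S strictly between g and X (t bounds the climb).
  below-greatest : ∀ {g} → g ∈ S → g ∣ X → g < X → Σ ℕ λ y → y ∈ ys × g ∣ y
  below-greatest = climb X (m≤m+n X _)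
    where
    between? : ∀ g z → Dec (g ∣ z × z ∣ X × ¬ z ≡ g × ¬ z ≡ X)
    between? g z = (g ∣? z) ×-dec ((z ∣? X) ×-dec (¬? (z ≟ g) ×-dec ¬? (z ≟ X)))
    climb : ∀ t {g} → X ≤ t + g → g ∈ S → g ∣ X → g < X → Σ ℕ λ y → y ∈ ys × g ∣ y
    climb t {g} X≤t+g g∈S g∣X g<X with any? (between? g) S
    ... | no none = g , Equivalence.from (ys-spec g) (g∈S , X∈S , g<X , g∣X , maximal) , ∣-refl
      where
      maximal : ∀ z → z ∈ S → g ∣ z → z ∣ X → z ≡ g ⊎ z ≡ X
      maximal z z∈S g∣z z∣X with z ≟ g | z ≟ X
      ... | yes z≡g | _       = inj₁ z≡g
      ... | no  _   | yes z≡X = inj₂ z≡X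
      ... | no  z≢g | no  z≢X = ⊥-elim (none (lose z∈S (g∣z , z∣X , z≢g , z≢X)))
    climb zero    X≤g _ _ g<X | yes _ = ⊥-elim (<⇒≱ g<X X≤g)
    climb (suc t) {g} X≤t+g _ _ _ | yes some with find some
    ... | z , z∈S , g∣z , z∣X , z≢g , z≢X =
      let (y , y∈ , z∣y) = climb t X≤t+z z∈S z∣X z<X in y , y∈ , ∣-trans g∣z z∣y
      where
      g<z : g < z
      g<z = ≤∧≢⇒< (∣⇒≤ {{>-nonZero (All.lookup S-pos z∈S)}} g∣z) (λ g≡z → z≢g (sym g≡z))
      z<X : z < X
      z<X = ≤∧≢⇒< (∣⇒≤ {{>-nonZero X-pos}} z∣X) z≢X
      X≤t+z : X ≤ t + z
      X≤t+z = ≤-trans X≤t+g (≤-trans (≤-reflexive (sym (+-suc t g))) (+-monoʳ-≤ t g<z))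

  -- By gcd-closedness, a divisor m of X divides no element of S below X
  -- iff it divides no greatest-type divisor of X (xt < X in S gives
  -- gcd xt X ∈ S, a proper divisor of X).
  c-cond-avoids : ∀ d k → c-cond S d X k ≡ avoids ys (k * d) ∧ ⌊ k * d ∣? X ⌋
  c-cond-avoids d k = bool-ext to from
    where
    m = k * d
    BelowX : ℕ → Set
    BelowX xt = xt < X → ¬ m ∣ xt
    to : T (c-cond S d X k) → T (avoids ys m ∧ ⌊ m ∣? X ⌋)
    to h with Equivalence.to (T-∧ {⌊ m ∣? X ⌋}) h
    ... | m∣X? , below? = Equivalence.from T-∧
      (avoids⁻ ys m (λ y∈ → All.lookup (toWitness below?) (y∈S y∈) (y<X y∈)) , m∣X?)
    from : T (avoids ys m ∧ ⌊ m ∣? X ⌋) → T (c-cond S d X k)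
    from h with Equivalence.to (T-∧ {avoids ys m}) h
    ... | avoid , m∣X? = Equivalence.from T-∧ (m∣X? , fromWitness (All.tabulate below))
      where
      below : ∀ {xt} → xt ∈ S → BelowX xt
      below {xt} xt∈S xt<X m∣xt with below-greatest (S-closed xt X xt∈S X∈S) (gcd[m,n]∣n xt X) g<X
        where
        g<X : gcd xt X < X
        g<X = ≤-<-trans (∣⇒≤ {{>-nonZero (All.lookup S-pos xt∈S)}} (gcd[m,n]∣m xt X)) xt<X
      ... | y , y∈ , g∣y = avoids⁺ ys m avoid y∈ (∣-trans (gcd-greatest m∣xt (toWitness m∣X?)) g∣y)

  c-as-sieve : ∀ d → c S d X ≡ sieve X ys X d
  c-as-sieve d = trans (c-sum-as-sumTo X) (∑ℤ.fold-ext (interval X) (λ k → cong (λ b → if b then μ k else + 0) (c-cond-avoids d k)))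
    where
    c-sum-as-sumTo : ∀ n → c-sum S d X n ≡ sumTo n (λ k → if c-cond S d X k then μ k else + 0)
    c-sum-as-sumTo zero    = refl
    c-sum-as-sumTo (suc n) = cong (λ t → (if c-cond S d X (suc n) then μ (suc n) else + 0) ℤ.+ t) (c-sum-as-sumTo n)

  v : List ℕ → ℕ
  v J = gcd X (gcdList J)

  c-formula : ∀ {d} → 1 ≤ d → c S d X ≡ ∑ℤ.fold (subsets ys) (λ J → sign (length J) ℤ.* + δ (v J) d)
  c-formula {d} 1≤d = trans (c-as-sieve d) (sieve-formula X ys X d X-pos ≤-refl 1≤d)

  -- Elements of D_S(X) are positive proper divisors of X other than the
  -- greatest-type divisors: if gcd of distinct y₁, y₂ ∈ ys were some
  -- y ∈ ys, maximality of y would give y₁ = y = y₂.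
  D-facts : ∀ {d} → d ∈ ds → 1 ≤ d × d < X × (∀ {y} → y ∈ ys → d ≢ y)
  D-facts {d} d∈ with Equivalence.to (ds-spec d) d∈
  ... | []           , _ , _ , ()        , _
  ... | (_ ∷ [])     , _ , _ , s≤s ()    , _
  ... | (y₁ ∷ y₂ ∷ T) , (y₁≢ AllPairs.∷ _) , (y₁∈ ∷ y₂∈ ∷ _) , _ , refl = g-pos , g<X , g≢y
    where
    g = gcdList (y₁ ∷ y₂ ∷ T)
    g∣y₁ : g ∣ y₁
    g∣y₁ = gcd[m,n]∣m y₁ _
    g∣y₂ : g ∣ y₂
    g∣y₂ = ∣-trans (gcd[m,n]∣n y₁ _) (gcd[m,n]∣m y₂ _)
    g-pos : 1 ≤ g
    g-pos = gcd-positive y₁ _ (y-pos y₁∈)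
    g<X : g < X
    g<X = ≤-<-trans (∣⇒≤ {{>-nonZero (y-pos y₁∈)}} g∣y₁) (y<X y₁∈)
    g≢y : ∀ {y} → y ∈ ys → g ≢ y
    g≢y {y} y∈ g≡y = All.head y₁≢ (trans (equals-y y₁∈ g∣y₁) (sym (equals-y y₂∈ g∣y₂)))
      where
      equals-y : ∀ {t} → t ∈ ys → g ∣ t → t ≡ y
      equals-y {t} t∈ g∣t with proj₂ (proj₂ (proj₂ (proj₂ (greatest y∈)))) t (y∈S t∈) (subst (_∣ t) g≡y g∣t) (y∣X t∈)
      ... | inj₁ t≡y = t≡y
      ... | inj₂ t≡X = contradiction t≡X (<⇒≢ (y<X t∈))

  v-∷ : ∀ {a} J → a ∈ ys → v (a ∷ J) ≡ gcdList (a ∷ J)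
  v-∷ {a} J a∈ = ∣-antisym (gcd[m,n]∣n X _) (gcd-greatest (∣-trans (gcd[m,n]∣m a _) (y∣X a∈)) ∣-refl)

  v-∈D : ∀ {J} → IsSubset ys J → 2 ≤ length J → v J ∈ ds
  v-∈D {a ∷ J} (uJ , J⊆@(a∈ ∷ _)) 2≤|J| =
    subst (_∈ ds) (sym (v-∷ J a∈)) (Equivalence.from (ds-spec _) ((a ∷ J) , uJ , J⊆ , 2≤|J| , refl))

  v-∉D : ∀ {J} → All (_∈ ys) J → length J < 2 → v J ∉ ds
  v-∉D {[]}     _         _ v∈ = <⇒≢ (proj₁ (proj₂ (D-facts X∈))) refl
    where
    X∈ : X ∈ ds
    X∈ = subst (_∈ ds) (gcd-identityʳ X) v∈
  v-∉D {a ∷ []} (a∈ ∷ _) _ v∈ = proj₂ (proj₂ (D-facts a∈ds)) a∈ refl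
    where
    a∈ds : a ∈ ds
    a∈ds = subst (_∈ ds) (trans (v-∷ [] a∈) (gcd-identityʳ a)) v∈
  v-∉D {_ ∷ _ ∷ _} _ (s≤s (s≤s ()))

  subsets-ys : All (IsSubset ys) (subsets ys)
  subsets-ys = subsets-are-subsets ys ys-unique

  weight : (ℕ → ℕ) → ℕ → ℕ
  weight w d = ∑.fold (subsets ys) (λ J → w (length J) * δ (v J) d)

  c-split : ∀ {d} → d ∈ ds → c S d X ≡ + weight evenAbove1 d ℤ.- + weight oddAbove1 d
  c-split {d} d∈ = begin
    c S d X                                                        ≡⟨ c-formula (proj₁ (D-facts d∈)) ⟩
    ∑ℤ.fold (subsets ys) (λ J → sign (length J) ℤ.* + δ (v J) d)   ≡⟨ ∑ℤ.fold-cong subsets-ys termwise ⟩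
    ∑ℤ.fold (subsets ys) (λ J → + E J ℤ.- + O J)                   ≡⟨ ∑ℤ-difference (subsets ys) E O ⟩
    + weight evenAbove1 d ℤ.- + weight oddAbove1 d                 ∎
    where
    open ≡-Reasoning
    E O : List ℕ → ℕ
    E J = evenAbove1 (length J) * δ (v J) d
    O J = oddAbove1 (length J) * δ (v J) d
    small : ∀ {J} → All (_∈ ys) J → length J < 2 → sign (length J) ℤ.* + δ (v J) d ≡ + 0
    small {J} J⊆ |J|<2 = trans (cong (λ t → sign (length J) ℤ.* + t) (δ-≢ (λ vJ≡d → v-∉D J⊆ |J|<2 (subst (_∈ ds) (sym vJ≡d) d∈))))
                              (ℤP.*-zeroʳ (sign (length J)))
    termwise : ∀ {J} → IsSubset ys J → sign (length J) ℤ.* + δ (v J) d ≡ + E J ℤ.- + O J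
    termwise {[]}        (_ , J⊆) = small J⊆ (s≤s z≤n)
    termwise {_ ∷ []}    (_ , J⊆) = small J⊆ (s≤s (s≤s z≤n))
    termwise {J@(_ ∷ _ ∷ _)} _    = sign-split (length J) (δ (v J) d)

  -- Summed over D_S(X), each J ⊆ ys with |J| ≥ 2 is counted exactly once.
  weight-total : ∀ w → w 0 ≡ 0 → w 1 ≡ 0 → ∑.fold ds (weight w) ≡ count w ys
  weight-total w w0≡0 w1≡0 = begin
    ∑.fold ds (λ d → ∑.fold (subsets ys) (λ J → w (length J) * δ (v J) d))  ≡⟨ ∑.fold-swap ds (subsets ys) _ ⟩
    ∑.fold (subsets ys) (λ J → ∑.fold ds (λ d → w (length J) * δ (v J) d))  ≡⟨ ∑.fold-ext (subsets ys) (λ J → ∑-scale ds (w (length J)) (δ (v J))) ⟩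
    ∑.fold (subsets ys) (λ J → w (length J) * ∑.fold ds (δ (v J)))          ≡⟨ ∑.fold-cong subsets-ys once ⟩
    count w ys                                                              ∎
    where
    open ≡-Reasoning
    once : ∀ {J} → IsSubset ys J → w (length J) * ∑.fold ds (δ (v J)) ≡ w (length J)
    once {[]}            _  = trans (cong (_* _) w0≡0) (sym w0≡0)
    once {_ ∷ []}        _  = trans (cong (_* _) w1≡0) (sym w1≡0)
    once {J@(_ ∷ _ ∷ _)} J⊆ =
      trans (cong (w (length J) *_) (∑δ-∈ ds ds-unique (v-∈D J⊆ (s≤s (s≤s z≤n))))) (*-identityʳ _)

  weight-product : ∀ w → w 0 ≡ 0 → w 1 ≡ 0 → ∏.fold ds (λ d → d ^ weight w d) ≡ gcdPower w ys
  weight-product w w0≡0 w1≡0 = begin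
    ∏.fold ds (λ d → d ^ weight w d)                                           ≡⟨ ∏.fold-ext ds (λ d → power-∑ d (subsets ys) _) ⟩
    ∏.fold ds (λ d → ∏.fold (subsets ys) (λ J → d ^ (w (length J) * δ (v J) d))) ≡⟨ ∏.fold-swap ds (subsets ys) _ ⟩
    ∏.fold (subsets ys) (λ J → ∏.fold ds (λ d → d ^ (w (length J) * δ (v J) d))) ≡⟨ ∏.fold-ext (subsets ys) (λ J → ∏δ (v J) (w (length J)) ds) ⟩
    ∏.fold (subsets ys) (λ J → v J ^ (w (length J) * ∑.fold ds (δ (v J))))      ≡⟨ ∏.fold-cong subsets-ys once ⟩
    gcdPower w ys                                                              ∎
    where
    open ≡-Reasoning
    once : ∀ {J} → IsSubset ys J → v J ^ (w (length J) * ∑.fold ds (δ (v J))) ≡ gcdList J ^ w (length J)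
    once {[]}     _ = trans (cong (λ e → v [] ^ (e * ∑.fold ds (δ (v [])))) w0≡0) (cong (gcdList [] ^_) (sym w0≡0))
    once {a ∷ []} _ = trans (cong (λ e → v (a ∷ []) ^ (e * ∑.fold ds (δ (v (a ∷ []))))) w1≡0)
                            (cong (gcdList (a ∷ []) ^_) (sym w1≡0))
    once {J@(a ∷ J′@(_ ∷ _))} J⊆@(_ , a∈ ∷ _) = cong₂ _^_ (v-∷ J′ a∈)
      (trans (cong (w (length J) *_) (∑δ-∈ ds ds-unique (v-∈D J⊆ (s≤s (s≤s z≤n))))) (*-identityʳ (w (length J))))

  exponent-sum : 1 ≤ length ys → sumℤ (map (λ d → c S d X) ds) ≡ + (length ys ∸ 1)
  exponent-sum 1≤m = begin
    ∑ℤ.fold ds (λ d → c S d X)                                             ≡⟨ ∑ℤ.fold-cong (All.tabulate (λ d∈ → d∈)) c-split ⟩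
    ∑ℤ.fold ds (λ d → + weight evenAbove1 d ℤ.- + weight oddAbove1 d)      ≡⟨ ∑ℤ-difference ds (weight evenAbove1) (weight oddAbove1) ⟩
    + ∑.fold ds (weight evenAbove1) ℤ.- + ∑.fold ds (weight oddAbove1)     ≡⟨ cong₂ (λ a b → + a ℤ.- + b) (weight-total evenAbove1 refl refl)
                                                                                                        (weight-total oddAbove1 refl refl) ⟩
    + count evenAbove1 ys ℤ.- + count oddAbove1 ys                         ≡⟨ difference-from-balance _ _ (length ys) 1≤m (balance ys 1≤m) ⟩
    + (length ys ∸ 1)                                                      ∎
    where
    open ≡-Reasoning
    balance : ∀ Y → 1 ≤ length Y → count evenAbove1 Y + 1 ≡ count oddAbove1 Y + length Y
    balance (y ∷ Y) _ = count-above1 y Y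

  -- lcm(ys) · Π_{d ∈ D} d^{c(d,X)⁺} = Π ys · Π_{d ∈ D} d^{c(d,X)⁻}: with
  -- Pᴱ, Pᴼ the products of d^{weight} over even and odd subsets,
  -- lcm(ys) · Pᴱ = Π ys · Pᴼ by inclusion–exclusion for the lcm, and
  -- P⁺ · Pᴼ = P⁻ · Pᴱ since c = weightᴱ − weightᴼ; cancel Pᴼ.
  lcm-formula : lcmList ys * ∏.fold ds (λ d → d ^ pos (c S d X)) ≡ product ys * ∏.fold ds (λ d → d ^ neg (c S d X))
  lcm-formula = *-cancelʳ-≡ _ _ Pᴼ {{Pᴼ≢0}} (begin
    L * P⁺ * Pᴼ       ≡⟨ *-assoc L P⁺ Pᴼ ⟩
    L * (P⁺ * Pᴼ)     ≡⟨ cong (L *_) exponents-balance ⟩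
    L * (P⁻ * Pᴱ)     ≡⟨ left-comm L P⁻ Pᴱ ⟩
    P⁻ * (L * Pᴱ)     ≡⟨ cong (P⁻ *_) lcm-even ⟩
    P⁻ * (Πys * Pᴼ)   ≡⟨ left-comm P⁻ Πys Pᴼ ⟩
    Πys * (P⁻ * Pᴼ)   ≡⟨ sym (*-assoc Πys P⁻ Pᴼ) ⟩
    Πys * P⁻ * Pᴼ     ∎)
    where
    open ≡-Reasoning
    L = lcmList ys
    Πys = product ys
    P⁺ = ∏.fold ds (λ d → d ^ pos (c S d X))
    P⁻ = ∏.fold ds (λ d → d ^ neg (c S d X))
    Pᴱ = ∏.fold ds (λ d → d ^ weight evenAbove1 d)
    Pᴼ = ∏.fold ds (λ d → d ^ weight oddAbove1 d)
    left-comm : ∀ x y z → x * (y * z) ≡ y * (x * z)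
    left-comm = solve-∀
    Pᴼ≢0 : NonZero Pᴼ
    Pᴼ≢0 = product≢0 (AllP.map⁺ (All.tabulate (λ {d} d∈ → m^n≢0 d (weight oddAbove1 d) {{>-nonZero (proj₁ (D-facts d∈))}})))
    lcm-even : L * Pᴱ ≡ Πys * Pᴼ
    lcm-even = begin
      L * Pᴱ                             ≡⟨ cong (L *_) (weight-product evenAbove1 refl refl) ⟩
      L * gcdPower evenAbove1 ys         ≡⟨ lcm-inclusion-exclusion ys ⟩
      gcdPower isOdd ys                  ≡⟨ gcdPower-odd ys ⟩
      Πys * gcdPower oddAbove1 ys        ≡⟨ cong (Πys *_) (sym (weight-product oddAbove1 refl refl)) ⟩
      Πys * Pᴼ                           ∎
    balanced : ∀ {d} → d ∈ ds → d ^ pos (c S d X) * d ^ weight oddAbove1 d ≡ d ^ neg (c S d X) * d ^ weight evenAbove1 d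
    balanced {d} d∈ = begin
      d ^ pos (c S d X) * d ^ weight oddAbove1 d    ≡⟨ sym (^-distribˡ-+-* d (pos (c S d X)) _) ⟩
      d ^ (pos (c S d X) + weight oddAbove1 d)      ≡⟨ cong (d ^_) (pos-neg-balance (c S d X) _ _ (c-split d∈)) ⟩
      d ^ (neg (c S d X) + weight evenAbove1 d)     ≡⟨ ^-distribˡ-+-* d (neg (c S d X)) _ ⟩
      d ^ neg (c S d X) * d ^ weight evenAbove1 d   ∎
    exponents-balance : P⁺ * Pᴼ ≡ P⁻ * Pᴱ
    exponents-balance = begin
      P⁺ * Pᴼ                                                                 ≡⟨ sym (∏.fold-∙ ds _ _) ⟩
      ∏.fold ds (λ d → d ^ pos (c S d X) * d ^ weight oddAbove1 d)            ≡⟨ ∏.fold-cong (All.tabulate (λ d∈ → d∈)) balanced ⟩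
      ∏.fold ds (λ d → d ^ neg (c S d X) * d ^ weight evenAbove1 d)           ≡⟨ ∏.fold-∙ ds _ _ ⟩
      P⁻ * Pᴱ                                                                 ∎

lemma2p9 : (S : List ℕ) → Unique S → All (λ x → 0 < x) S → GcdClosed S →
           (xn : ℕ) → xn ∈ S →
           (ys : List ℕ) → Unique ys →
           (∀ y → (y ∈ ys) ⇔ IsGreatestTypeDivisor S y xn) →
           1 ≤ length ys →
           (ds : List ℕ) → Unique ds →
           (∀ d → (d ∈ ds) ⇔ InD ys d) →
           (lcmList ys * product (map (λ d → d ^ pos (c S d xn)) ds)
              ≡ product ys * product (map (λ d → d ^ neg (c S d xn)) ds))
           × (sumℤ (map (λ d → c S d xn) ds) ≡ + (length ys ∸ 1))
lemma2p9 S _ S-pos S-closed xn xn∈S ys ys-unique ys-spec 1≤m ds ds-unique ds-spec =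
  lcm-formula , exponent-sum 1≤m
  where open GreatestTypeDivisors S S-pos S-closed xn xn∈S ys ys-unique ys-spec ds ds-unique ds-spec
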